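{- Let $n\in\mathbb{P}$ and $M=\{m_1<m_2<\dots<m_t\}\subseteq[0,n-1]$, and put $m_{t+1}:=n$. Then $$\sum_{\{\beta\in B_n\mid\operatorname{Des}_B(\beta^{ -1})\subseteq M\}} q^{\ell_D(\beta)}=\begin{bmatrix} n\\ m_1,\ m_2-m_1,\ \dots,\ n-m_t\end{bmatrix}_q\prod_{i=m_1}^{n-1}(1+q^i).$$
   Context: $B_n$ is the group of bijections $\beta$ of $[-n,n]\setminus\{0\}$ with $\beta(-i)=-\beta(i)$, composed as functions, in window notation $[\beta(1),\dots,\beta(n)]$. $\operatorname{Des}_B(\beta)=\{i\in[0,n-1]\mid\beta(i)>\beta(i+1)\}$ with $\beta(0):=0$. $\operatorname{inv}(\beta)=|\{(i,j):1\le i<j\le n,\beta(i)>\beta(j)\}|$, $\operatorname{N}_2(\beta)=|\{\{i,j\}\subseteq[n],i\ne j:\beta(i)+\beta(j)<0\}|$, and $\ell_D(\beta):=\operatorname{inv}(\beta)+\operatorname{N}_2(\beta)$ for every $\beta\in B_n$. $[k]_q=1+q+\dots+q^{k-1}$, $[k]_q!=[k]_q\cdots[1]_q$ ($[0]_q!=1$), and $\begin{bmatrix} n\\ a_1,\dots,a_s\end{bmatrix}_q=\frac{[n]_q!}{[a_1]_q!\cdots[a_s]_q!}$. -}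

module Defs where

open import Data.Bool using (Bool; true; false; if_then_else_; _∧_; _∨_; not)
open import Data.Nat as ℕ using (ℕ; zero; suc; _+_; _*_; _∸_; _^_; NonZero; _≡ᵇ_)
open import Data.Nat.Properties using (m*n≢0)
open import Data.Nat.DivMod using (_/_)
open import Data.Integer as ℤ using (ℤ; +_; -_; ∣_∣)
open import Data.List using (List; []; _∷_; _++_; [_]; map; upTo;
  filterᵇ; concatMap; length; zipWith; allFin)
open import Data.Nat.ListAction using (sum; product)
open import Data.Bool.ListAction using (all; any)
open import Data.Fin using (Fin; toℕ)
open import Data.Fin.Subset using (Subset)
open import Data.Vec using (lookup)
open import Relation.Nullary.Decidable using (⌊_⌋)

-- Signed permutations, in window notation [β(1),…,β(n)] as a list of
-- integers.

signedAlphabet : ℕ → List ℤ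
signedAlphabet n = map (λ i → - (+ suc i)) (upTo n) ++ map (λ i → + suc i) (upTo n)

words : {A : Set} → List A → ℕ → List (List A)
words as zero    = [] ∷ []
words as (suc k) = concatMap (λ a → map (a ∷_) (words as k)) as

distinct : List ℕ → Bool
distinct []       = true
distinct (x ∷ xs) = not (any (x ≡ᵇ_) xs) ∧ distinct xs

-- A window [β(1),…,β(n)] with entries in [-n,n]\{0} determines an element of
-- B_n (via β(-i) = -β(i)) iff the absolute values |β(1)|,…,|β(n)| are
-- pairwise distinct.
B : ℕ → List (List ℤ)
B n = filterᵇ (λ w → distinct (map ∣_∣ w)) (words (signedAlphabet n) n)

-- β⁻¹(j) for j ≥ 1: the position k with β(k) = ±j, signed accordingly
-- (search starts at position k)
invAt : ℕ → List ℤ → ℕ → ℤ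
invAt j []       k = + 0
invAt j (x ∷ xs) k =
  if ∣ x ∣ ≡ᵇ j then (if ⌊ + 0 ℤ.<? x ⌋ then + k else - (+ k)) else invAt j xs (suc k)

inverse : List ℤ → List ℤ
inverse w = map (λ j → invAt (suc j) w 1) (upTo (length w))

-- Des_B of a window v = [v(1),…,v(n)], with v(0) := 0:
-- the list of i ∈ [0,n-1] with v(i) > v(i+1)
desFrom : ℕ → ℤ → List ℤ → List ℕ
desFrom i prev []       = []
desFrom i prev (x ∷ xs) =
  (if ⌊ x ℤ.<? prev ⌋ then i ∷ [] else []) ++ desFrom (suc i) x xs

DesB : List ℤ → List ℕ
DesB v = desFrom 0 (+ 0) v

invStat : List ℤ → ℕ
invStat []       = 0
invStat (x ∷ xs) = length (filterᵇ (λ y → ⌊ y ℤ.<? x ⌋) xs) + invStat xs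

N2 : List ℤ → ℕ
N2 []       = 0
N2 (x ∷ xs) = length (filterᵇ (λ y → ⌊ x ℤ.+ y ℤ.<? + 0 ⌋) xs) + N2 xs

ℓD : List ℤ → ℕ
ℓD β = invStat β + N2 β

elems : {n : ℕ} → Subset n → List ℕ
elems {n} M = map toℕ (filterᵇ (λ i → lookup M i) (allFin n))

_∈ᵇ_ : ℕ → List ℕ → Bool
i ∈ᵇ xs = any (i ≡ᵇ_) xs

desSubset : {n : ℕ} → List ℤ → Subset n → Bool
desSubset v M = all (λ i → i ∈ᵇ elems M) (DesB v)

-- m₁ (with the convention m₁ = m_{t+1} = n when M = ∅)
firstElem : (n : ℕ) → List ℕ → ℕ
firstElem n []      = n
firstElem n (m ∷ _) = m

-- the composition (m₁, m₂ - m₁, …, n - m_t)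
parts : (n : ℕ) → List ℕ → List ℕ
parts n ms = zipWith (λ a b → b ∸ a) (0 ∷ ms) (ms ++ [ n ])

-- q-analogues, evaluated at a natural number q

qint : ℕ → ℕ → ℕ
qint q k = sum (map (q ^_) (upTo k))

qfact : ℕ → ℕ → ℕ
qfact q zero    = 1
qfact q (suc k) = qint q (suc k) * qfact q k

qfact-nonZero : ∀ q k → NonZero (qfact q k)
qfact-nonZero q zero    = _
qfact-nonZero q (suc k) = m*n≢0 (qint q (suc k)) (qfact q k) {{_}} {{qfact-nonZero q k}}

prodQfact-nonZero : ∀ q as → NonZero (product (map (qfact q) as))
prodQfact-nonZero q []       = _
prodQfact-nonZero q (a ∷ as) =
  m*n≢0 (qfact q a) (product (map (qfact q) as)) {{qfact-nonZero q a}} {{prodQfact-nonZero q as}}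

qMultinomial : ℕ → ℕ → List ℕ → ℕ
qMultinomial q n as = (qfact q n / product (map (qfact q) as)) {{prodQfact-nonZero q as}}

prodRange : ℕ → ℕ → (ℕ → ℕ) → ℕ
prodRange a b f = product (map (λ i → f (a + i)) (upTo (b ∸ a)))

-- Build β letter by letter (its window as a word) and track β⁻¹:
-- the condition Des_B(β⁻¹) ⊆ M says that β⁻¹ (with β⁻¹(0) = 0) is weakly
-- increasing on each block [0,m₁], (m₁,m₂], …, (m_t,n] of values.  We
-- generalise to partial words whose absolute values form an arbitrary set s
-- (always containing the phantom value 0), with generating function W s k.
-- Appending a last letter ±j gives β⁻¹(j) = ±(k+1), which is admissible only
-- if j is the top (+j) or bottom (-j) of s in its block, and raises ℓD by a
-- count of elements of s.  This recursion (W-step) proves by induction on k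
--     W s k · ∏_b [c_b]_q! = [k]_q! · ∏_{i=c₀}^{k-1} (1+q^i),
-- (c_b = #(s ∩ block b), c₀ for the first block) where the block sums
-- telescope to q-integers and close with a q-Pascal-type identity.  The
-- theorem is the case s = [0,n], k = n, divided by ∏ [parts]!.
module Submission where

open import Defs
open import Data.Nat using (ℕ; _+_; _*_; _^_; _≤_)
open import Data.List using (map; filterᵇ)
open import Data.Nat.ListAction using (sum)
open import Data.Fin.Subset using (Subset)
open import Relation.Binary.PropositionalEquality using (_≡_)

open import Data.Nat as ℕ using (zero; suc; _∸_; _<_; z≤n; s≤s; pred; _≡ᵇ_; _<ᵇ_; _≤ᵇ_; NonZero)
open import Data.Nat.DivMod using (_/_; m*n/n≡m)
import Data.Nat.Properties as ℕₚ
open ℕₚ using (+-comm; +-assoc; +-identityʳ; +-suc; *-comm; *-assoc; *-zeroʳ; *-identityʳ;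
  ≤-refl; ≤-trans; ≤-reflexive; <-trans; ≤-<-trans; <-≤-trans; <⇒≤; <⇒≱; <⇒≢; ≤∧≢⇒<; ≤-pred)
open import Data.Nat.Tactic.RingSolver using (solve-∀)
open import Data.Integer as ℤ using (ℤ; -[1+_]; ∣_∣)
import Data.Integer.Properties as ℤₚ
open import Data.List using (List; []; _∷_; _++_; [_]; length; concatMap; applyUpTo; upTo)
open import Data.Nat.ListAction using (product)
open import Data.Bool using (Bool; true; false; if_then_else_; _∧_; _∨_; not; T)
open import Data.Unit using (tt)
open import Data.Empty using (⊥; ⊥-elim)
open import Data.Product using (Σ; _×_; _,_; proj₁; proj₂)
open import Data.Sum using (_⊎_; inj₁; inj₂; [_,_]′)
open import Function using (_∘_)
open import Relation.Binary.PropositionalEquality using (refl; sym; trans; cong; cong₂; subst; subst₂; _≢_; module ≡-Reasoning)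
open import Relation.Nullary using (¬_; yes; no)
open import Relation.Binary.Definitions using (tri<; tri≈; tri>)
open import Relation.Nullary.Decidable using (⌊_⌋; isYes≗does)
open import Data.Bool.Properties using (T-≡; T-not-≡; T-∧)
open import Function.Bundles using (Equivalence)
open import Data.List.Membership.Propositional using (_∈_)
open import Data.List.Relation.Unary.Any using (here; there)
open import Data.List.Relation.Unary.All using (All; []; _∷_)

𝟙 : Bool → ℕ
𝟙 b = if b then 1 else 0

T⇒≡true : ∀ {b} → T b → b ≡ true
T⇒≡true = Equivalence.to T-≡

≡true⇒T : ∀ {b} → b ≡ true → T b
≡true⇒T = Equivalence.from T-≡

¬T⇒≡false : ∀ {b} → ¬ T b → b ≡ false
¬T⇒≡false {false} _ = refl
¬T⇒≡false {true}  h = ⊥-elim (h tt)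

bool-ext : ∀ {a b : Bool} → (T a → T b) → (T b → T a) → a ≡ b
bool-ext {false} {false} f g = refl
bool-ext {false} {true}  f g = ⊥-elim (g tt)
bool-ext {true}  {false} f g = ⊥-elim (f tt)
bool-ext {true}  {true}  f g = refl

∧-fst : ∀ {a b} → T (a ∧ b) → T a
∧-fst h = proj₁ (Equivalence.to T-∧ h)

∧-snd : ∀ {a b} → T (a ∧ b) → T b
∧-snd {a} h = proj₂ (Equivalence.to (T-∧ {a}) h)

∧-intro : ∀ {a b} → T a → T b → T (a ∧ b)
∧-intro ta tb = Equivalence.from T-∧ (ta , tb)

not-intro : ∀ {a} → ¬ T a → T (not a)
not-intro {false} _ = tt
not-intro {true}  h = h tt

not-elim : ∀ {a} → T (not a) → ¬ T a
not-elim {false} _ ()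

_⇒ᵇ_ : Bool → Bool → Bool
a ⇒ᵇ b = not a ∨ b

⇒ᵇ-elim : ∀ {a b} → T (a ⇒ᵇ b) → T a → T b
⇒ᵇ-elim {true} h _ = h

⇒ᵇ-intro : ∀ {a b} → (T a → T b) → T (a ⇒ᵇ b)
⇒ᵇ-intro {false} f = tt
⇒ᵇ-intro {true}  f = f tt

_⇔ᵇ_ : Bool → Bool → Bool
a ⇔ᵇ b = (a ∧ b) ∨ (not a ∧ not b)

⇔ᵇ-elim : ∀ {a b} → T (a ⇔ᵇ b) → a ≡ b
⇔ᵇ-elim {true}  {true}  _ = refl
⇔ᵇ-elim {false} {false} _ = refl

⇔ᵇ-intro : ∀ {a b} → a ≡ b → T (a ⇔ᵇ b)
⇔ᵇ-intro {true}  refl = tt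
⇔ᵇ-intro {false} refl = tt

allBelow : ℕ → (ℕ → Bool) → Bool
allBelow zero    p = true
allBelow (suc d) p = p d ∧ allBelow d p

allBelow-elim : ∀ d p → T (allBelow d p) → ∀ t → t < d → T (p t)
allBelow-elim (suc d) p h t lt with t ℕ.≟ d
... | yes refl = ∧-fst h
... | no ne    = allBelow-elim d p (∧-snd {p d} h) t (≤∧≢⇒< (≤-pred lt) ne)

allBelow-intro : ∀ d p → (∀ t → t < d → T (p t)) → T (allBelow d p)
allBelow-intro zero    p f = tt
allBelow-intro (suc d) p f = ∧-intro (f d ≤-refl) (allBelow-intro d p (λ t lt → f t (ℕₚ.m<n⇒m<1+n lt)))

+-interchange : ∀ a b c d → a + b + (c + d) ≡ a + c + (b + d)
+-interchange = solve-∀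

ΣL : {A : Set} → List A → (A → ℕ) → ℕ
ΣL xs f = sum (map f xs)

module _ {A : Set} where

  ΣL-++ : (xs ys : List A) (f : A → ℕ) → ΣL (xs ++ ys) f ≡ ΣL xs f + ΣL ys f
  ΣL-++ []       ys f = refl
  ΣL-++ (x ∷ xs) ys f = trans (cong (f x +_) (ΣL-++ xs ys f)) (sym (+-assoc (f x) _ _))

  ΣL-cong : (xs : List A) {f g : A → ℕ} → (∀ x → x ∈ xs → f x ≡ g x) → ΣL xs f ≡ ΣL xs g
  ΣL-cong []       h = refl
  ΣL-cong (x ∷ xs) h = cong₂ _+_ (h x (here refl)) (ΣL-cong xs (λ y p → h y (there p)))

  ΣL-+ : (xs : List A) (f g : A → ℕ) → ΣL xs (λ x → f x + g x) ≡ ΣL xs f + ΣL xs g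
  ΣL-+ []       f g = refl
  ΣL-+ (x ∷ xs) f g = trans (cong (f x + g x +_) (ΣL-+ xs f g)) (+-interchange (f x) (g x) _ _)

  ΣL-* : (xs : List A) (c : ℕ) (f : A → ℕ) → ΣL xs (λ x → c * f x) ≡ c * ΣL xs f
  ΣL-* []       c f = sym (*-zeroʳ c)
  ΣL-* (x ∷ xs) c f = trans (cong (c * f x +_) (ΣL-* xs c f)) (sym (ℕₚ.*-distribˡ-+ c (f x) (ΣL xs f)))

  ΣL-*ʳ : (xs : List A) (f : A → ℕ) (c : ℕ) → ΣL xs (λ x → f x * c) ≡ ΣL xs f * c
  ΣL-*ʳ xs f c = trans (ΣL-cong xs (λ x _ → *-comm (f x) c)) (trans (ΣL-* xs c f) (*-comm c (ΣL xs f)))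

  ΣL-0 : (xs : List A) → ΣL xs (λ _ → 0) ≡ 0
  ΣL-0 []       = refl
  ΣL-0 (x ∷ xs) = ΣL-0 xs

  ΣL-if : (xs : List A) (c : Bool) (a : ℕ) (f : A → ℕ) →
    ΣL xs (λ x → if c then a * f x else 0) ≡ (if c then a * ΣL xs f else 0)
  ΣL-if xs false a f = ΣL-0 xs
  ΣL-if xs true  a f = ΣL-* xs a f

  ΣL-filter : (xs : List A) (p : A → Bool) (f : A → ℕ) →
    ΣL (filterᵇ p xs) f ≡ ΣL xs (λ x → if p x then f x else 0)
  ΣL-filter []       p f = refl
  ΣL-filter (x ∷ xs) p f with p x
  ... | true  = cong (f x +_) (ΣL-filter xs p f)
  ... | false = ΣL-filter xs p f

module _ {A B : Set} where

  ΣL-map : (xs : List A) (g : A → B) (f : B → ℕ) → ΣL (map g xs) f ≡ ΣL xs (f ∘ g)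
  ΣL-map []       g f = refl
  ΣL-map (x ∷ xs) g f = cong (f (g x) +_) (ΣL-map xs g f)

  ΣL-concatMap : (xs : List A) (g : A → List B) (f : B → ℕ) →
    ΣL (concatMap g xs) f ≡ ΣL xs (λ x → ΣL (g x) f)
  ΣL-concatMap []       g f = refl
  ΣL-concatMap (x ∷ xs) g f =
    trans (ΣL-++ (g x) (concatMap g xs) f) (cong (ΣL (g x) f +_) (ΣL-concatMap xs g f))

ΣR : ℕ → ℕ → (ℕ → ℕ) → ℕ
ΣR lo zero    f = 0
ΣR lo (suc d) f = f (suc lo) + ΣR (suc lo) d f

ΣI : ℕ → ℕ → (ℕ → ℕ) → ℕ
ΣI lo hi f = ΣR lo (hi ∸ lo) f

lo<t≤lo+0-absurd : ∀ {lo t} → lo < t → t ≤ lo + 0 → ⊥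
lo<t≤lo+0-absurd {lo} p q = <⇒≱ p (≤-trans q (≤-reflexive (+-identityʳ lo)))

ΣR-split : ∀ lo a b f → ΣR lo (a + b) f ≡ ΣR lo a f + ΣR (lo + a) b f
ΣR-split lo zero    b f = cong (λ z → ΣR z b f) (sym (+-identityʳ lo))
ΣR-split lo (suc a) b f =
  trans (cong (f (suc lo) +_) (trans (ΣR-split (suc lo) a b f)
          (cong (λ z → ΣR (suc lo) a f + ΣR z b f) (sym (+-suc lo a)))))
        (sym (+-assoc (f (suc lo)) _ _))

ΣR-cong : ∀ lo d {f g : ℕ → ℕ} → (∀ t → lo < t → t ≤ lo + d → f t ≡ g t) → ΣR lo d f ≡ ΣR lo d g
ΣR-cong lo zero    h = refl
ΣR-cong lo (suc d) h =
  cong₂ _+_ (h (suc lo) ≤-refl (≤-trans (s≤s (ℕₚ.m≤m+n lo d)) (≤-reflexive (sym (+-suc lo d)))))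
            (ΣR-cong (suc lo) d (λ t p q → h t (<-trans (ℕₚ.n<1+n lo) p) (≤-trans q (≤-reflexive (sym (+-suc lo d))))))

ΣR-+ : ∀ lo d f g → ΣR lo d (λ t → f t + g t) ≡ ΣR lo d f + ΣR lo d g
ΣR-+ lo zero    f g = refl
ΣR-+ lo (suc d) f g = trans (cong (f (suc lo) + g (suc lo) +_) (ΣR-+ (suc lo) d f g))
                          (+-interchange (f (suc lo)) (g (suc lo)) (ΣR (suc lo) d f) (ΣR (suc lo) d g))

ΣR-* : ∀ lo d c f → ΣR lo d (λ t → c * f t) ≡ c * ΣR lo d f
ΣR-* lo zero    c f = sym (*-zeroʳ c)
ΣR-* lo (suc d) c f = trans (cong (c * f (suc lo) +_) (ΣR-* (suc lo) d c f)) (sym (ℕₚ.*-distribˡ-+ c _ _))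

ΣR-*ʳ : ∀ lo d (f : ℕ → ℕ) c → ΣR lo d f * c ≡ ΣR lo d (λ t → f t * c)
ΣR-*ʳ lo d f c = trans (*-comm (ΣR lo d f) c) (trans (sym (ΣR-* lo d c f)) (ΣR-cong lo d (λ t _ _ → *-comm c (f t))))

ΣR-0 : ∀ lo d → ΣR lo d (λ _ → 0) ≡ 0
ΣR-0 lo zero    = refl
ΣR-0 lo (suc d) = ΣR-0 (suc lo) d

ΣR-zero : ∀ lo d (f : ℕ → ℕ) → (∀ t → lo < t → t ≤ lo + d → f t ≡ 0) → ΣR lo d f ≡ 0
ΣR-zero lo d f h = trans (ΣR-cong lo d h) (ΣR-0 lo d)

ΣR-shift : ∀ lo d f → ΣR (suc lo) d f ≡ ΣR lo d (λ t → f (suc t))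
ΣR-shift lo zero    f = refl
ΣR-shift lo (suc d) f = cong (f (suc (suc lo)) +_) (ΣR-shift (suc lo) d f)

ΣR-from0 : ∀ a b g → ΣR a b g ≡ ΣR 0 b (λ t → g (a + t))
ΣR-from0 zero    b g = refl
ΣR-from0 (suc a) b g = trans (ΣR-shift a b g) (ΣR-from0 a b (λ t → g (suc t)))

ΣL-ΣR : {A : Set} (xs : List A) (lo d : ℕ) (f : A → ℕ → ℕ) →
  ΣL xs (λ x → ΣR lo d (f x)) ≡ ΣR lo d (λ t → ΣL xs (λ x → f x t))
ΣL-ΣR []       lo d f = sym (ΣR-0 lo d)
ΣL-ΣR (x ∷ xs) lo d f = trans (cong (ΣR lo d (f x) +_) (ΣL-ΣR xs lo d f)) (sym (ΣR-+ lo d (f x) _))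

ΣL-applyUpTo : ∀ {A : Set} d (F : ℕ → A) (h : A → ℕ) → ΣL (applyUpTo F d) h ≡ ΣR 0 d (λ t → h (F (pred t)))
ΣL-applyUpTo zero    F h = refl
ΣL-applyUpTo (suc d) F h = cong (h (F 0) +_) (trans (ΣL-applyUpTo d (λ t → F (suc t)) h)
  (trans (ΣR-cong 0 d (λ { (suc t) _ _ → refl })) (sym (ΣR-shift 0 d (λ t → h (F (pred t)))))))

ΣR-≤ : ∀ lo d (g : ℕ → ℕ) → (∀ t → g t ≤ 1) → ΣR lo d g ≤ d
ΣR-≤ lo zero    g h = z≤n
ΣR-≤ lo (suc d) g h = ℕₚ.+-mono-≤ (h (suc lo)) (ΣR-≤ (suc lo) d g h)

ΣR-full : ∀ lo d (g : ℕ → ℕ) → (∀ t → g t ≤ 1) → ΣR lo d g ≡ d → ∀ t → lo < t → t ≤ lo + d → g t ≡ 1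
ΣR-full lo zero    g h e t p q = ⊥-elim (lo<t≤lo+0-absurd p q)
ΣR-full lo (suc d) g h e t p q with g (suc lo) in eg | h (suc lo)
... | zero     | _ = ⊥-elim (ℕₚ.<-irrefl refl (≤-trans (≤-reflexive (sym e)) (ΣR-≤ (suc lo) d g h)))
... | suc zero | _ with suc lo ℕ.≟ t
...   | yes refl = eg
...   | no ne    = ΣR-full (suc lo) d g h (ℕₚ.suc-injective e) t (≤∧≢⇒< p ne) (≤-trans q (≤-reflexive (+-suc lo d)))
ΣR-full lo (suc d) g h e t p q | suc (suc _) | s≤s ()

ΣR-zero-inv : ∀ lo d (f : ℕ → ℕ) → ΣR lo d f ≡ 0 → ∀ t → lo < t → t ≤ lo + d → f t ≡ 0
ΣR-zero-inv lo zero    f e t p q = ⊥-elim (lo<t≤lo+0-absurd p q)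
ΣR-zero-inv lo (suc d) f e t p q with suc lo ℕ.≟ t
... | yes refl = ℕₚ.m+n≡0⇒m≡0 (f (suc lo)) e
... | no ne    = ΣR-zero-inv (suc lo) d f (ℕₚ.m+n≡0⇒n≡0 (f (suc lo)) e) t (≤∧≢⇒< p ne) (≤-trans q (≤-reflexive (+-suc lo d)))

ΣR-const1 : ∀ lo d → ΣR lo d (λ _ → 1) ≡ d
ΣR-const1 lo zero    = refl
ΣR-const1 lo (suc d) = cong suc (ΣR-const1 (suc lo) d)

∸-split : ∀ lo m hi → lo ≤ m → m ≤ hi → (m ∸ lo) + (hi ∸ m) ≡ hi ∸ lo
∸-split lo m hi p q = ℕₚ.+-cancelˡ-≡ lo _ _ (begin
  lo + ((m ∸ lo) + (hi ∸ m)) ≡⟨ sym (+-assoc lo (m ∸ lo) (hi ∸ m)) ⟩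
  lo + (m ∸ lo) + (hi ∸ m)   ≡⟨ cong (_+ (hi ∸ m)) (ℕₚ.m+[n∸m]≡n p) ⟩
  m + (hi ∸ m)               ≡⟨ ℕₚ.m+[n∸m]≡n q ⟩
  hi                         ≡⟨ sym (ℕₚ.m+[n∸m]≡n (≤-trans p q)) ⟩
  lo + (hi ∸ lo)             ∎)
  where open ≡-Reasoning

ΣI-split : ∀ lo m hi f → lo ≤ m → m ≤ hi → ΣI lo hi f ≡ ΣI lo m f + ΣI m hi f
ΣI-split lo m hi f p q =
  trans (cong (λ d → ΣR lo d f) (sym (∸-split lo m hi p q)))
        (trans (ΣR-split lo (m ∸ lo) (hi ∸ m) f) (cong (λ z → ΣI lo m f + ΣR z (hi ∸ m) f) (ℕₚ.m+[n∸m]≡n p)))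

ΣI-cong : ∀ lo hi {f g : ℕ → ℕ} → (∀ t → lo < t → t ≤ hi → f t ≡ g t) → ΣI lo hi f ≡ ΣI lo hi g
ΣI-cong lo hi {f} {g} h with lo ℕₚ.≤? hi
... | yes p = ΣR-cong lo (hi ∸ lo) (λ t a b → h t a (≤-trans b (≤-reflexive (ℕₚ.m+[n∸m]≡n p))))
... | no p  = trans (cong (λ d → ΣR lo d f) empty) (sym (cong (λ d → ΣR lo d g) empty))
  where
  empty : hi ∸ lo ≡ 0
  empty = ℕₚ.m≤n⇒m∸n≡0 (<⇒≤ (ℕₚ.≰⇒> p))

ΣI-zero : ∀ lo hi (f : ℕ → ℕ) → (∀ t → lo < t → t ≤ hi → f t ≡ 0) → ΣI lo hi f ≡ 0
ΣI-zero lo hi f h = trans (ΣI-cong lo hi h) (ΣR-0 lo (hi ∸ lo))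

module _ {A : Set} where

  words-snoc : (as : List A) (k : ℕ) (f : List A → ℕ) →
    ΣL (words as (suc k)) f ≡ ΣL (words as k) (λ w → ΣL as (λ x → f (w ++ [ x ])))
  words-snoc as zero f =
    trans (ΣL-concatMap as (λ a → map (a ∷_) ([] ∷ [])) f)
          (trans (ΣL-cong as (λ a _ → +-identityʳ _)) (sym (+-identityʳ _)))
  words-snoc as (suc k) f = begin
    ΣL (concatMap (λ a → map (a ∷_) (words as (suc k))) as) f
      ≡⟨ ΣL-concatMap as _ f ⟩
    ΣL as (λ a → ΣL (map (a ∷_) (words as (suc k))) f)
      ≡⟨ ΣL-cong as (λ a _ → trans (ΣL-map (words as (suc k)) (a ∷_) f) (words-snoc as k (λ w → f (a ∷ w)))) ⟩
    ΣL as (λ a → ΣL (words as k) (λ w → ΣL as (λ x → f (a ∷ w ++ [ x ]))))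
      ≡⟨ ΣL-cong as (λ a _ → sym (ΣL-map (words as k) (a ∷_) g)) ⟩
    ΣL as (λ a → ΣL (map (a ∷_) (words as k)) g)
      ≡⟨ sym (ΣL-concatMap as (λ a → map (a ∷_) (words as k)) g) ⟩
    ΣL (words as (suc k)) g ∎
    where
    open ≡-Reasoning
    g : List A → ℕ
    g w = ΣL as (λ x → f (w ++ [ x ]))

  words-cong : (P : A → Set) (as : List A) → (∀ a → a ∈ as → P a) → (k : ℕ) → {f g : List A → ℕ} →
    (∀ w → All P w → length w ≡ k → f w ≡ g w) → ΣL (words as k) f ≡ ΣL (words as k) g
  words-cong P as h zero    e = cong (_+ 0) (e [] [] refl)
  words-cong P as h (suc k) {f} {g} e =
    trans (ΣL-concatMap as (λ a → map (a ∷_) (words as k)) f)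
      (trans (ΣL-cong as (λ a m → trans (ΣL-map (words as k) (a ∷_) f)
                (trans (words-cong P as h k (λ w pw lw → e (a ∷ w) (h a m ∷ pw) (cong suc lw)))
                       (sym (ΣL-map (words as k) (a ∷_) g)))))
             (sym (ΣL-concatMap as (λ a → map (a ∷_) (words as k)) g)))

-- The length ℓD under appending a letter.  inv and N₂ both count pairs of
-- positions i < j whose entries satisfy a test r, so appending x adds one for
-- every earlier entry y with r y x.  Together: appending +t adds the number
-- of earlier entries of absolute value above t, and appending -t adds the
-- number of earlier entries plus those of absolute value below t.

pairCount : {A : Set} → (A → A → Bool) → List A → ℕ
pairCount r []       = 0
pairCount r (x ∷ xs) = length (filterᵇ (r x) xs) + pairCount r xs

length-filterᵇ-snoc : {A : Set} (p : A → Bool) (xs : List A) (x : A) →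
  length (filterᵇ p (xs ++ [ x ])) ≡ length (filterᵇ p xs) + 𝟙 (p x)
length-filterᵇ-snoc p [] x with p x
... | true  = refl
... | false = refl
length-filterᵇ-snoc p (y ∷ xs) x with p y
... | true  = cong suc (length-filterᵇ-snoc p xs x)
... | false = length-filterᵇ-snoc p xs x

pairCount-snoc : {A : Set} (r : A → A → Bool) (w : List A) (x : A) →
  pairCount r (w ++ [ x ]) ≡ pairCount r w + ΣL w (λ y → 𝟙 (r y x))
pairCount-snoc r []      x = refl
pairCount-snoc r (y ∷ w) x = begin
  length (filterᵇ (r y) (w ++ [ x ])) + pairCount r (w ++ [ x ])
    ≡⟨ cong₂ _+_ (length-filterᵇ-snoc (r y) w x) (pairCount-snoc r w x) ⟩
  length (filterᵇ (r y) w) + 𝟙 (r y x) + (pairCount r w + ΣL w (λ z → 𝟙 (r z x)))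
    ≡⟨ +-interchange (length (filterᵇ (r y) w)) _ _ _ ⟩
  length (filterᵇ (r y) w) + pairCount r w + (𝟙 (r y x) + ΣL w (λ z → 𝟙 (r z x))) ∎
  where open ≡-Reasoning

module _ where
  open import Data.Integer.Base using (+_)

  invStat≡pairCount : ∀ w → invStat w ≡ pairCount (λ x y → ⌊ y ℤ.<? x ⌋) w
  invStat≡pairCount []       = refl
  invStat≡pairCount (x ∷ xs) = cong (_+_ (length (filterᵇ (λ y → ⌊ y ℤ.<? x ⌋) xs))) (invStat≡pairCount xs)

  N2≡pairCount : ∀ w → N2 w ≡ pairCount (λ x y → ⌊ x ℤ.+ y ℤ.<? + 0 ⌋) w
  N2≡pairCount []       = refl
  N2≡pairCount (x ∷ xs) = cong (_+_ (length (filterᵇ (λ y → ⌊ x ℤ.+ y ℤ.<? + 0 ⌋) xs))) (N2≡pairCount xs)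

  ℓD-snoc : ∀ w x → ℓD (w ++ [ x ]) ≡ ℓD w + ΣL w (λ y → 𝟙 ⌊ x ℤ.<? y ⌋ + 𝟙 ⌊ y ℤ.+ x ℤ.<? + 0 ⌋)
  ℓD-snoc w x = begin
    invStat (w ++ [ x ]) + N2 (w ++ [ x ])
      ≡⟨ cong₂ _+_ (invStat≡pairCount (w ++ [ x ])) (N2≡pairCount (w ++ [ x ])) ⟩
    pairCount r₁ (w ++ [ x ]) + pairCount r₂ (w ++ [ x ])
      ≡⟨ cong₂ _+_ (pairCount-snoc r₁ w x) (pairCount-snoc r₂ w x) ⟩
    pairCount r₁ w + ΣL w (λ y → 𝟙 (r₁ y x)) + (pairCount r₂ w + ΣL w (λ y → 𝟙 (r₂ y x)))
      ≡⟨ +-interchange (pairCount r₁ w) _ _ _ ⟩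
    pairCount r₁ w + pairCount r₂ w + (ΣL w (λ y → 𝟙 (r₁ y x)) + ΣL w (λ y → 𝟙 (r₂ y x)))
      ≡⟨ cong₂ (λ a b → a + b + (ΣL w (λ y → 𝟙 (r₁ y x)) + ΣL w (λ y → 𝟙 (r₂ y x)))) (sym (invStat≡pairCount w)) (sym (N2≡pairCount w)) ⟩
    ℓD w + (ΣL w (λ y → 𝟙 (r₁ y x)) + ΣL w (λ y → 𝟙 (r₂ y x)))
      ≡⟨ cong (_+_ (ℓD w)) (sym (ΣL-+ w _ _)) ⟩
    ℓD w + ΣL w (λ y → 𝟙 (r₁ y x) + 𝟙 (r₂ y x)) ∎
    where
    open ≡-Reasoning
    r₁ r₂ : ℤ → ℤ → Bool
    r₁ a b = ⌊ b ℤ.<? a ⌋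
    r₂ a b = ⌊ a ℤ.+ b ℤ.<? + 0 ⌋

  ⊖-negative : ∀ a b → ⌊ (a ℤ.⊖ b) ℤ.<? + 0 ⌋ ≡ (a <ᵇ b)
  ⊖-negative a b with a ℕ.<? b
  ... | yes p = begin
    ⌊ (a ℤ.⊖ b) ℤ.<? + 0 ⌋       ≡⟨ cong (λ z → ⌊ z ℤ.<? + 0 ⌋) (ℤₚ.⊖-< p) ⟩
    ⌊ - (+ (b ∸ a)) ℤ.<? + 0 ⌋   ≡⟨ negative (ℕₚ.m<n⇒0<n∸m p) ⟩
    true                          ≡⟨ sym (T⇒≡true (ℕₚ.<⇒<ᵇ p)) ⟩
    (a <ᵇ b)                      ∎
    where
    open ≡-Reasoning
    open import Data.Integer.Base using (-_)
    negative : ∀ {c} → 0 < c → ⌊ - (+ c) ℤ.<? + 0 ⌋ ≡ true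
    negative {suc c} _ = refl
  ... | no p = begin
    ⌊ (a ℤ.⊖ b) ℤ.<? + 0 ⌋    ≡⟨ cong (λ z → ⌊ z ℤ.<? + 0 ⌋) (ℤₚ.⊖-≥ (ℕₚ.≮⇒≥ p)) ⟩
    ⌊ + (a ∸ b) ℤ.<? + 0 ⌋    ≡⟨ isYes≗does (+ (a ∸ b) ℤ.<? + 0) ⟩
    false                      ≡⟨ sym (¬T⇒≡false (λ t → p (ℕₚ.<ᵇ⇒< a b t))) ⟩
    (a <ᵇ b)                   ∎
    where open ≡-Reasoning

  letterWeight⁺ : ∀ t y → 𝟙 ⌊ + t ℤ.<? y ⌋ + 𝟙 ⌊ y ℤ.+ + t ℤ.<? + 0 ⌋ ≡ 𝟙 (t <ᵇ ∣ y ∣)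
  letterWeight⁺ t (+ j) =
    trans (cong₂ (λ a b → 𝟙 a + 𝟙 b) (isYes≗does (+ t ℤ.<? + j)) (isYes≗does (+ (j + t) ℤ.<? + 0))) (+-identityʳ _)
  letterWeight⁺ t -[1+ j ] = cong 𝟙 (⊖-negative t (suc j))

  letterWeight⁻ : ∀ i y → 𝟙 ⌊ -[1+ i ] ℤ.<? y ⌋ + 𝟙 ⌊ y ℤ.+ -[1+ i ] ℤ.<? + 0 ⌋ ≡ 1 + 𝟙 (∣ y ∣ <ᵇ suc i)
  letterWeight⁻ i (+ j)    = cong (λ b → 1 + 𝟙 b) (⊖-negative j (suc i))
  letterWeight⁻ i -[1+ j ] =
    trans (cong (λ b → 𝟙 b + 1) (isYes≗does (-[1+ i ] ℤ.<? -[1+ j ]))) (+-comm (𝟙 (j <ᵇ i)) 1)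

-- V w t = invAt t w 1 is β⁻¹(t): the position of ±t in w, signed like that
-- entry, and 0 when t does not occur (so V w 0 = 0).
module _ where
  open import Data.Integer.Base using (+_; -_)
  open import Data.List.Membership.Propositional.Properties using (∈-map⁻; ∈-++⁻; ∈-applyUpTo⁻)

  Letter : ℕ → ℤ → Set
  Letter n x = Σ ℕ (λ i → i < n × (x ≡ + suc i ⊎ x ≡ -[1+ i ]))

  alphabet-Letter : ∀ n x → x ∈ signedAlphabet n → Letter n x
  alphabet-Letter n x m with ∈-++⁻ (map (λ i → - (+ suc i)) (upTo n)) m
  ... | inj₁ m₁ with ∈-map⁻ (λ i → - (+ suc i)) m₁
  ...   | i , mi , refl with ∈-applyUpTo⁻ (λ z → z) mi
  ...     | j , j<n , refl = j , j<n , inj₂ refl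
  alphabet-Letter n x m | inj₂ m₂ with ∈-map⁻ (λ i → + suc i) m₂
  ...   | i , mi , refl with ∈-applyUpTo⁻ (λ z → z) mi
  ...     | j , j<n , refl = j , j<n , inj₁ refl

  ΣL-alphabet : ∀ n (g : ℤ → ℕ) → ΣL (signedAlphabet n) g ≡ ΣR 0 n (λ t → g (- (+ t))) + ΣR 0 n (λ t → g (+ t))
  ΣL-alphabet n g = trans (ΣL-++ (map (λ i → - (+ suc i)) (upTo n)) _ g) (cong₂ _+_ (half _) (half _))
    where
    half : (h : ℕ → ℤ) → ΣL (map (h ∘ suc) (upTo n)) g ≡ ΣR 0 n (g ∘ h)
    half h = trans (ΣL-map (upTo n) (h ∘ suc) g)
               (trans (ΣL-applyUpTo n (λ i → i) (g ∘ h ∘ suc)) (ΣR-cong 0 n (λ { (suc t) _ _ → refl })))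

  V : List ℤ → ℕ → ℤ
  V w t = invAt t w 1

  sgnAt : ℤ → ℕ → ℤ
  sgnAt x k = if ⌊ + 0 ℤ.<? x ⌋ then + k else - (+ k)

  invAt-snoc-other : ∀ j w x k → (∣ x ∣ ≡ᵇ j) ≡ false → invAt j (w ++ [ x ]) k ≡ invAt j w k
  invAt-snoc-other j []      x k e rewrite e = refl
  invAt-snoc-other j (y ∷ w) x k e with ∣ y ∣ ≡ᵇ j
  ... | true  = refl
  ... | false = invAt-snoc-other j w x (suc k) e

  invAt-snoc-new : ∀ j w x k → (j ∈ᵇ map ∣_∣ w) ≡ false → (∣ x ∣ ≡ᵇ j) ≡ true →
    invAt j (w ++ [ x ]) k ≡ sgnAt x (k + length w)
  invAt-snoc-new j []      x k _  e₂ rewrite e₂ | +-identityʳ k = refl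
  invAt-snoc-new j (y ∷ w) x k e₁ e₂ with j ≡ᵇ ∣ y ∣ in eq | ∣ y ∣ ≡ᵇ j in eq′
  ... | true  | _     = ⊥-elim (subst T e₁ tt)
  ... | false | true  = ⊥-elim (subst T eq (ℕₚ.≡⇒≡ᵇ j ∣ y ∣ (sym (ℕₚ.≡ᵇ⇒≡ ∣ y ∣ j (≡true⇒T eq′)))))
  ... | false | false = trans (invAt-snoc-new j w x (suc k) e₁ e₂) (cong (sgnAt x) (sym (+-suc k (length w))))

  ∣sgnAt∣ : ∀ y k → ∣ sgnAt y k ∣ ≡ k
  ∣sgnAt∣ y k with ⌊ + 0 ℤ.<? y ⌋
  ... | true  = refl
  ... | false = ℤₚ.∣-i∣≡∣i∣ (+ k)

  invAt-bound : ∀ j w k → 1 ≤ k → ∣ invAt j w k ∣ < k + length w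
  invAt-bound j []      k p = ≤-trans p (≤-reflexive (sym (+-identityʳ k)))
  invAt-bound j (y ∷ w) k p with ∣ y ∣ ≡ᵇ j
  ... | true  = ≤-trans (s≤s (≤-reflexive (∣sgnAt∣ y k)))
                  (≤-trans (ℕₚ.m≤m+n (suc k) (length w)) (≤-reflexive (sym (+-suc k (length w)))))
  ... | false = ≤-trans (invAt-bound j w (suc k) (s≤s z≤n)) (≤-reflexive (sym (+-suc k (length w))))

  V-old : ∀ w x t → t ≢ ∣ x ∣ → V (w ++ [ x ]) t ≡ V w t
  V-old w x t ne = invAt-snoc-other t w x 1 (¬T⇒≡false (λ h → ne (sym (ℕₚ.≡ᵇ⇒≡ ∣ x ∣ t h))))

  V-new : ∀ w x → (∣ x ∣ ∈ᵇ map ∣_∣ w) ≡ false → V (w ++ [ x ]) ∣ x ∣ ≡ sgnAt x (suc (length w))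
  V-new w x e = invAt-snoc-new ∣ x ∣ w x 1 e (T⇒≡true (ℕₚ.≡⇒≡ᵇ ∣ x ∣ ∣ x ∣ refl))

  V-range : ∀ w t → -[1+ length w ] ℤ.< V w t × V w t ℤ.< + suc (length w)
  V-range w t = within (V w t) (invAt-bound t w 1 (s≤s z≤n))
    where
    within : ∀ z {L} → ∣ z ∣ < suc L → -[1+ L ] ℤ.< z × z ℤ.< + suc L
    within (+ a)    p       = ℤ.-<+ , ℤ.+<+ p
    within -[1+ a ] (s≤s p) = ℤ.-<- p , ℤ.-<+

  V-zero : ∀ {n} w → All (Letter n) w → V w 0 ≡ + 0
  V-zero w = go w 1
    where
    go : ∀ {n} w k → All (Letter n) w → invAt 0 w k ≡ + 0
    go []      k []                           = refl
    go (_ ∷ w) k ((i , _ , inj₁ refl) ∷ ls) = go w (suc k) ls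
    go (_ ∷ w) k ((i , _ , inj₂ refl) ∷ ls) = go w (suc k) ls

≡ᵇ-refl : ∀ a → (a ≡ᵇ a) ≡ true
≡ᵇ-refl a = T⇒≡true (ℕₚ.≡⇒≡ᵇ a a refl)

≡ᵇ-≢ : ∀ a b → a ≢ b → (a ≡ᵇ b) ≡ false
≡ᵇ-≢ a b p = ¬T⇒≡false (λ t → p (ℕₚ.≡ᵇ⇒≡ a b t))

≡ᵇ-sym : ∀ a b → (a ≡ᵇ b) ≡ (b ≡ᵇ a)
≡ᵇ-sym a b = bool-ext (λ t → ℕₚ.≡⇒≡ᵇ b a (sym (ℕₚ.≡ᵇ⇒≡ a b t))) (λ t → ℕₚ.≡⇒≡ᵇ a b (sym (ℕₚ.≡ᵇ⇒≡ b a t)))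

∈ᵇ-++ : ∀ x xs ys → x ∈ᵇ (xs ++ ys) ≡ (x ∈ᵇ xs) ∨ (x ∈ᵇ ys)
∈ᵇ-++ x []       ys = refl
∈ᵇ-++ x (y ∷ xs) ys rewrite ∈ᵇ-++ x xs ys with x ≡ᵇ y
... | true  = refl
... | false = refl

distinct-snoc : ∀ xs y → distinct (xs ++ [ y ]) ≡ distinct xs ∧ not (y ∈ᵇ xs)
distinct-snoc []       y = refl
distinct-snoc (x ∷ xs) y rewrite distinct-snoc xs y | ∈ᵇ-++ x xs [ y ] | ≡ᵇ-sym x y =
  reassociate (x ∈ᵇ xs) (y ≡ᵇ x) (distinct xs) (y ∈ᵇ xs)
  where
  reassociate : ∀ a e d b → not (a ∨ (e ∨ false)) ∧ (d ∧ not b) ≡ (not a ∧ d) ∧ not (e ∨ b)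
  reassociate true  e     d     b     = refl
  reassociate false true  false b     = refl
  reassociate false true  true  b     = refl
  reassociate false false false b     = refl
  reassociate false false true  false = refl
  reassociate false false true  true  = refl

InRange : ℕ → ℕ → Set
InRange n y = 1 ≤ y × y ≤ n

ΣR-delta : ∀ lo d y (f : ℕ → ℕ) → lo < y → y ≤ lo + d → ΣR lo d (λ t → if t ≡ᵇ y then f t else 0) ≡ f y
ΣR-delta lo zero    y f p q = ⊥-elim (lo<t≤lo+0-absurd p q)
ΣR-delta lo (suc d) y f p q with suc lo ℕ.≟ y
... | yes refl rewrite ≡ᵇ-refl (suc lo) =
  trans (cong (f (suc lo) +_) (ΣR-zero (suc lo) d _ (λ t lt _ →
          cong (λ b → if b then f t else 0) (≡ᵇ-≢ t (suc lo) (λ e → ℕₚ.<-irrefl (sym e) lt)))))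
        (+-identityʳ _)
... | no ne rewrite ≡ᵇ-≢ (suc lo) y ne =
  ΣR-delta (suc lo) d y f (≤∧≢⇒< p ne) (≤-trans q (≤-reflexive (+-suc lo d)))

ΣL-distinct : ∀ n (L : List ℕ) (f : ℕ → ℕ) → T (distinct L) → All (InRange n) L →
  ΣL L f ≡ ΣR 0 n (λ t → if t ∈ᵇ L then f t else 0)
ΣL-distinct n []      f d a = sym (ΣR-0 0 n)
ΣL-distinct n (y ∷ L) f d ((1≤y , y≤n) ∷ a) = begin
  f y + ΣL L f
    ≡⟨ cong₂ _+_ (sym (ΣR-delta 0 n y f 1≤y y≤n)) (ΣL-distinct n L f (∧-snd {not (y ∈ᵇ L)} d) a) ⟩
  ΣR 0 n (λ t → if t ≡ᵇ y then f t else 0) + ΣR 0 n (λ t → if t ∈ᵇ L then f t else 0)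
    ≡⟨ sym (ΣR-+ 0 n _ _) ⟩
  ΣR 0 n (λ t → (if t ≡ᵇ y then f t else 0) + (if t ∈ᵇ L then f t else 0))
    ≡⟨ ΣR-cong 0 n (λ t _ _ → disjoint t) ⟩
  ΣR 0 n (λ t → if (t ≡ᵇ y) ∨ (t ∈ᵇ L) then f t else 0) ∎
  where
  open ≡-Reasoning
  y∉L : y ∈ᵇ L ≡ false
  y∉L = Equivalence.to T-not-≡ (∧-fst d)
  disjoint : ∀ t → (if t ≡ᵇ y then f t else 0) + (if t ∈ᵇ L then f t else 0) ≡ (if (t ≡ᵇ y) ∨ (t ∈ᵇ L) then f t else 0)
  disjoint t with t ≡ᵇ y in eq
  ... | true rewrite ℕₚ.≡ᵇ⇒≡ t y (≡true⇒T eq) | y∉L = +-identityʳ (f y)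
  ... | false = refl

ΣL-const1 : {A : Set} (L : List A) → ΣL L (λ _ → 1) ≡ length L
ΣL-const1 []      = refl
ΣL-const1 (x ∷ L) = cong suc (ΣL-const1 L)

pigeonhole : ∀ n (L : List ℕ) → T (distinct L) → All (InRange n) L → length L ≡ n →
  ∀ t → 1 ≤ t → t ≤ n → t ∈ᵇ L ≡ true
pigeonhole n L d a l t p q = indicator-one (ΣR-full 0 n (λ t → 𝟙 (t ∈ᵇ L)) 𝟙≤1 full t p q)
  where
  𝟙≤1 : ∀ t → 𝟙 (t ∈ᵇ L) ≤ 1
  𝟙≤1 t with t ∈ᵇ L
  ... | true  = ≤-refl
  ... | false = z≤n
  indicator-one : ∀ {b} → 𝟙 b ≡ 1 → b ≡ true
  indicator-one {true} _ = refl
  full : ΣR 0 n (λ t → 𝟙 (t ∈ᵇ L)) ≡ n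
  full = trans (sym (ΣL-distinct n L (λ _ → 1) d a)) (trans (ΣL-const1 L) l)

-- We generalise from B_n to partial signed permutations.
-- A value set s : ℕ → Bool is a set of values; the value 0 stands for the
-- fixed point β⁻¹(0) = 0.  A word w uses s if its absolute values are
-- distinct and are exactly the elements of s in [1,n].  The cuts of M split
-- [0,n] into the blocks [0,m₁], (m₁,m₂], …, (m_t,n]; w is block-monotone on s
-- if β⁻¹ = V w is weakly increasing on s within every block.  For s = all of
-- [0,n], the admissible words (using s and block-monotone) are exactly the
-- β ∈ B_n with Des_B(β⁻¹) ⊆ M.  Appending a letter ±j to an admissible word
-- makes β⁻¹(j) = ±(length + 1) extremal, so it is admissible exactly when j
-- is the top (for +j), resp. the bottom (for -j), of s in its block.
module Admissible (n : ℕ) (ms : List ℕ) where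
  open import Data.Integer.Base using (+_)
  open import Data.List.Properties using (map-++)
  open import Data.Bool.Properties using (∧-zeroʳ; ∧-identityʳ; ∨-zeroʳ; ∨-identityʳ)
  open import Data.Bool.ListAction using (any)

  -- a ≤ b lie in the same block: no cut m ∈ M with a ≤ m < b.
  noCut : ℕ → ℕ → Bool
  noCut a b = not (any (λ m → (a ≤ᵇ m) ∧ (m <ᵇ b)) ms)

  absL : List ℤ → List ℕ
  absL w = map ∣_∣ w

  Uses : (ℕ → Bool) → List ℤ → Set
  Uses s w = T (distinct (absL w)) × (∀ t → 1 ≤ t → t ≤ n → s t ≡ (t ∈ᵇ absL w))

  usesᵇ : (ℕ → Bool) → List ℤ → Bool
  usesᵇ s w = distinct (absL w) ∧ allBelow n (λ t → s (suc t) ⇔ᵇ (suc t ∈ᵇ absL w))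

  BlockMonotone : (ℕ → Bool) → List ℤ → Set
  BlockMonotone s w = ∀ t t′ → t ≤ n → t′ ≤ n → T (s t) → T (s t′) → t < t′ → T (noCut t t′) → V w t ℤ.≤ V w t′

  monotoneᵇ : (ℕ → Bool) → List ℤ → Bool
  monotoneᵇ s w = allBelow (suc n) (λ t → allBelow (suc n) (λ t′ →
    (s t ∧ (s t′ ∧ ((t <ᵇ t′) ∧ noCut t t′))) ⇒ᵇ (V w t ℤ.≤ᵇ V w t′)))

  admissible : (ℕ → Bool) → List ℤ → Bool
  admissible s w = usesᵇ s w ∧ monotoneᵇ s w

  uses-elim : ∀ s w → T (usesᵇ s w) → Uses s w
  uses-elim s w h = ∧-fst h , λ { (suc t) _ t<n → ⇔ᵇ-elim (allBelow-elim n _ (∧-snd {distinct (absL w)} h) t t<n) }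

  uses-intro : ∀ s w → Uses s w → T (usesᵇ s w)
  uses-intro s w (d , e) = ∧-intro d (allBelow-intro n _ (λ t t<n → ⇔ᵇ-intro (e (suc t) (s≤s z≤n) t<n)))

  monotone-elim : ∀ s w → T (monotoneᵇ s w) → BlockMonotone s w
  monotone-elim s w h t t′ t≤n t′≤n st st′ lt nc =
    ℤₚ.≤ᵇ⇒≤ (⇒ᵇ-elim (allBelow-elim (suc n) _ (allBelow-elim (suc n) _ h t (s≤s t≤n)) t′ (s≤s t′≤n))
                     (∧-intro st (∧-intro st′ (∧-intro (ℕₚ.<⇒<ᵇ lt) nc))))

  monotone-intro : ∀ s w → BlockMonotone s w → T (monotoneᵇ s w)
  monotone-intro s w g = allBelow-intro (suc n) _ (λ t t<n → allBelow-intro (suc n) _ (λ t′ t′<n → ⇒ᵇ-intro λ h →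
    let st′∧rest = ∧-snd {s t} h
        lt∧nc    = ∧-snd {s t′} st′∧rest
    in ℤₚ.≤⇒≤ᵇ (g t t′ (≤-pred t<n) (≤-pred t′<n) (∧-fst h) (∧-fst st′∧rest)
                  (ℕₚ.<ᵇ⇒< t t′ (∧-fst lt∧nc)) (∧-snd {t <ᵇ t′} lt∧nc))))

  _∖_ : (ℕ → Bool) → ℕ → ℕ → Bool
  (s ∖ j) t = s t ∧ not (t ≡ᵇ j)

  ∖-self : ∀ s j → (s ∖ j) j ≡ false
  ∖-self s j rewrite ≡ᵇ-refl j = ∧-zeroʳ (s j)

  ∖-other : ∀ s j t → t ≢ j → (s ∖ j) t ≡ s t
  ∖-other s j t ne rewrite ≡ᵇ-≢ t j ne = ∧-identityʳ (s t)

  ∖-elim : ∀ s j t → T ((s ∖ j) t) → T (s t) × t ≢ j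
  ∖-elim s j t h = ∧-fst h , λ e → not-elim (∧-snd {s t} h) (ℕₚ.≡⇒≡ᵇ t j e)

  ∖-intro : ∀ s j t → T (s t) → t ≢ j → T ((s ∖ j) t)
  ∖-intro s j t st ne = subst T (sym (∖-other s j t ne)) st

  TopOf : (ℕ → Bool) → ℕ → Set
  TopOf s j = ∀ t′ → t′ ≤ n → T (s t′) → j < t′ → ¬ T (noCut j t′)

  BottomOf : (ℕ → Bool) → ℕ → Set
  BottomOf s j = ∀ t → t ≤ n → T (s t) → t < j → ¬ T (noCut t j)

  isTop isBottom : (ℕ → Bool) → ℕ → Bool
  isTop    s j = allBelow (suc n) (λ t′ → not (s t′ ∧ ((j <ᵇ t′) ∧ noCut j t′)))
  isBottom s j = allBelow (suc n) (λ t → not (s t ∧ ((t <ᵇ j) ∧ noCut t j)))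

  isTop-elim : ∀ s j → T (isTop s j) → TopOf s j
  isTop-elim s j h t′ t′≤n st′ lt nc =
    not-elim (allBelow-elim (suc n) _ h t′ (s≤s t′≤n)) (∧-intro st′ (∧-intro (ℕₚ.<⇒<ᵇ lt) nc))

  isTop-intro : ∀ s j → TopOf s j → T (isTop s j)
  isTop-intro s j top = allBelow-intro (suc n) _ (λ t′ t′<n → not-intro (λ h →
    top t′ (≤-pred t′<n) (∧-fst h) (ℕₚ.<ᵇ⇒< j t′ (∧-fst (∧-snd {s t′} h))) (∧-snd {j <ᵇ t′} (∧-snd {s t′} h))))

  isBottom-elim : ∀ s j → T (isBottom s j) → BottomOf s j
  isBottom-elim s j h t t≤n st lt nc =
    not-elim (allBelow-elim (suc n) _ h t (s≤s t≤n)) (∧-intro st (∧-intro (ℕₚ.<⇒<ᵇ lt) nc))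

  isBottom-intro : ∀ s j → BottomOf s j → T (isBottom s j)
  isBottom-intro s j bot = allBelow-intro (suc n) _ (λ t t<n → not-intro (λ h →
    bot t (≤-pred t<n) (∧-fst h) (ℕₚ.<ᵇ⇒< t j (∧-fst (∧-snd {s t} h))) (∧-snd {t <ᵇ j} (∧-snd {s t} h))))

  ∈ᵇ-absL-snoc : ∀ t w x → t ∈ᵇ absL (w ++ [ x ]) ≡ (t ∈ᵇ absL w) ∨ ((t ≡ᵇ ∣ x ∣) ∨ false)
  ∈ᵇ-absL-snoc t w x = trans (cong (t ∈ᵇ_) (map-++ ∣_∣ w [ x ])) (∈ᵇ-++ t (absL w) [ ∣ x ∣ ])

  ∈ᵇ-absL-snoc-self : ∀ w x → ∣ x ∣ ∈ᵇ absL (w ++ [ x ]) ≡ true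
  ∈ᵇ-absL-snoc-self w x =
    trans (∈ᵇ-absL-snoc ∣ x ∣ w x) (trans (cong (λ b → (∣ x ∣ ∈ᵇ absL w) ∨ (b ∨ false)) (≡ᵇ-refl ∣ x ∣)) (∨-zeroʳ _))

  ∈ᵇ-absL-snoc-other : ∀ t w x → t ≢ ∣ x ∣ → t ∈ᵇ absL (w ++ [ x ]) ≡ t ∈ᵇ absL w
  ∈ᵇ-absL-snoc-other t w x ne =
    trans (∈ᵇ-absL-snoc t w x) (trans (cong (λ b → (t ∈ᵇ absL w) ∨ (b ∨ false)) (≡ᵇ-≢ t ∣ x ∣ ne)) (∨-identityʳ _))

  ∉-uses-removed : ∀ s w j → 1 ≤ j → j ≤ n → Uses (s ∖ j) w → (j ∈ᵇ absL w) ≡ false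
  ∉-uses-removed s w j 1≤j j≤n (_ , e) = trans (sym (e j 1≤j j≤n)) (∖-self s j)

  uses-snoc⇒ : ∀ s w x → Uses s (w ++ [ x ]) → 1 ≤ ∣ x ∣ → ∣ x ∣ ≤ n → s ∣ x ∣ ≡ true × Uses (s ∖ ∣ x ∣) w
  uses-snoc⇒ s w x (d , e) 1≤j j≤n = trans (e j 1≤j j≤n) (∈ᵇ-absL-snoc-self w x) , ∧-fst d′ , e′
    where
    j = ∣ x ∣
    d′ : T (distinct (absL w) ∧ not (j ∈ᵇ absL w))
    d′ = subst T (trans (cong distinct (map-++ ∣_∣ w [ x ])) (distinct-snoc (absL w) j)) d
    e′ : ∀ t → 1 ≤ t → t ≤ n → (s ∖ j) t ≡ (t ∈ᵇ absL w)
    e′ t 1≤t t≤n with t ℕ.≟ j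
    ... | yes refl = trans (∖-self s j) (sym (Equivalence.to T-not-≡ (∧-snd {distinct (absL w)} d′)))
    ... | no ne    = trans (∖-other s j t ne) (trans (e t 1≤t t≤n) (∈ᵇ-absL-snoc-other t w x ne))

  uses-snoc⇐ : ∀ s w x → 1 ≤ ∣ x ∣ → ∣ x ∣ ≤ n → s ∣ x ∣ ≡ true → Uses (s ∖ ∣ x ∣) w → Uses s (w ++ [ x ])
  uses-snoc⇐ s w x 1≤j j≤n sj u@(d , e) = d′ , e′
    where
    j = ∣ x ∣
    d′ : T (distinct (absL (w ++ [ x ])))
    d′ = subst T (sym (trans (cong distinct (map-++ ∣_∣ w [ x ])) (distinct-snoc (absL w) j)))
               (∧-intro d (Equivalence.from T-not-≡ (∉-uses-removed s w j 1≤j j≤n u)))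
    e′ : ∀ t → 1 ≤ t → t ≤ n → s t ≡ (t ∈ᵇ absL (w ++ [ x ]))
    e′ t 1≤t t≤n with t ℕ.≟ j
    ... | yes refl = trans sj (sym (∈ᵇ-absL-snoc-self w x))
    ... | no ne    = trans (sym (∖-other s j t ne)) (trans (e t 1≤t t≤n) (sym (∈ᵇ-absL-snoc-other t w x ne)))

  monotone-snoc⇒ : ∀ s w x → BlockMonotone s (w ++ [ x ]) → BlockMonotone (s ∖ ∣ x ∣) w
  monotone-snoc⇒ s w x g t t′ t≤n t′≤n st st′ lt nc =
    subst₂ ℤ._≤_ (V-old w x t (proj₂ t∈)) (V-old w x t′ (proj₂ t′∈)) (g t t′ t≤n t′≤n (proj₁ t∈) (proj₁ t′∈) lt nc)
    where
    t∈  = ∖-elim s ∣ x ∣ t st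
    t′∈ = ∖-elim s ∣ x ∣ t′ st′

  -- A last letter +j sits at the largest position, so j must be the top of its block; dually for -j.
  top-of-snoc : ∀ s w i → suc i ≤ n → Uses s (w ++ [ + suc i ]) → BlockMonotone s (w ++ [ + suc i ]) → TopOf s (suc i)
  top-of-snoc s w i j≤n u g t′ t′≤n st′ lt nc =
    ℤₚ.<⇒≱ (proj₂ (V-range w t′))
      (subst₂ ℤ._≤_ (V-new w (+ suc i) (∉-uses-removed s w (suc i) (s≤s z≤n) j≤n removed)) (V-old w (+ suc i) t′ (λ e → <⇒≢ lt (sym e)))
        (g (suc i) t′ j≤n t′≤n (≡true⇒T (proj₁ (uses-snoc⇒ s w (+ suc i) u (s≤s z≤n) j≤n))) st′ lt nc))
    where removed = proj₂ (uses-snoc⇒ s w (+ suc i) u (s≤s z≤n) j≤n)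

  bottom-of-snoc : ∀ s w i → suc i ≤ n → Uses s (w ++ [ -[1+ i ] ]) → BlockMonotone s (w ++ [ -[1+ i ] ]) → BottomOf s (suc i)
  bottom-of-snoc s w i j≤n u g t t≤n st lt nc =
    ℤₚ.<⇒≱ (proj₁ (V-range w t))
      (subst₂ ℤ._≤_ (V-old w -[1+ i ] t (<⇒≢ lt)) (V-new w -[1+ i ] (∉-uses-removed s w (suc i) (s≤s z≤n) j≤n removed))
        (g t (suc i) t≤n j≤n st (≡true⇒T (proj₁ (uses-snoc⇒ s w -[1+ i ] u (s≤s z≤n) j≤n))) lt nc))
    where removed = proj₂ (uses-snoc⇒ s w -[1+ i ] u (s≤s z≤n) j≤n)

  monotone-snoc⁺⇐ : ∀ s w i → suc i ≤ n → TopOf s (suc i) → Uses (s ∖ suc i) w → BlockMonotone (s ∖ suc i) w →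
    BlockMonotone s (w ++ [ + suc i ])
  monotone-snoc⁺⇐ s w i j≤n top u g t t′ t≤n t′≤n st st′ lt nc with t ℕ.≟ suc i | t′ ℕ.≟ suc i
  ... | yes refl | _        = ⊥-elim (top t′ t′≤n st′ lt nc)
  ... | no ne    | yes refl =
    subst₂ ℤ._≤_ (sym (V-old w (+ suc i) t ne)) (sym (V-new w (+ suc i) (∉-uses-removed s w (suc i) (s≤s z≤n) j≤n u)))
      (ℤₚ.<⇒≤ (proj₂ (V-range w t)))
  ... | no ne    | no ne′   =
    subst₂ ℤ._≤_ (sym (V-old w (+ suc i) t ne)) (sym (V-old w (+ suc i) t′ ne′))
      (g t t′ t≤n t′≤n (∖-intro s (suc i) t st ne) (∖-intro s (suc i) t′ st′ ne′) lt nc)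

  monotone-snoc⁻⇐ : ∀ s w i → suc i ≤ n → BottomOf s (suc i) → Uses (s ∖ suc i) w → BlockMonotone (s ∖ suc i) w →
    BlockMonotone s (w ++ [ -[1+ i ] ])
  monotone-snoc⁻⇐ s w i j≤n bot u g t t′ t≤n t′≤n st st′ lt nc with t ℕ.≟ suc i | t′ ℕ.≟ suc i
  ... | yes refl | _        =
    subst₂ ℤ._≤_ (sym (V-new w -[1+ i ] (∉-uses-removed s w (suc i) (s≤s z≤n) j≤n u))) (sym (V-old w -[1+ i ] t′ (λ e → <⇒≢ lt (sym e))))
      (ℤₚ.<⇒≤ (proj₁ (V-range w t′)))
  ... | no ne    | yes refl = ⊥-elim (bot t t≤n st lt nc)
  ... | no ne    | no ne′   =
    subst₂ ℤ._≤_ (sym (V-old w -[1+ i ] t ne)) (sym (V-old w -[1+ i ] t′ ne′))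
      (g t t′ t≤n t′≤n (∖-intro s (suc i) t st ne) (∖-intro s (suc i) t′ st′ ne′) lt nc)

  admissible-snoc⁺ : ∀ s w i → suc i ≤ n →
    admissible s (w ++ [ + suc i ]) ≡ (s (suc i) ∧ isTop s (suc i)) ∧ admissible (s ∖ suc i) w
  admissible-snoc⁺ s w i j≤n = bool-ext to from
    where
    x = + suc i
    to : T (admissible s (w ++ [ x ])) → T ((s (suc i) ∧ isTop s (suc i)) ∧ admissible (s ∖ suc i) w)
    to h = let u = uses-elim s (w ++ [ x ]) (∧-fst h)
               g = monotone-elim s (w ++ [ x ]) (∧-snd {usesᵇ s (w ++ [ x ])} h)
               (sj , u′) = uses-snoc⇒ s w x u (s≤s z≤n) j≤n
           in ∧-intro (∧-intro (≡true⇒T sj) (isTop-intro s (suc i) (top-of-snoc s w i j≤n u g)))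
                      (∧-intro (uses-intro (s ∖ suc i) w u′) (monotone-intro (s ∖ suc i) w (monotone-snoc⇒ s w x g)))
    from : T ((s (suc i) ∧ isTop s (suc i)) ∧ admissible (s ∖ suc i) w) → T (admissible s (w ++ [ x ]))
    from h = let sj∧top = ∧-fst h
                 adm    = ∧-snd {s (suc i) ∧ isTop s (suc i)} h
                 u′     = uses-elim (s ∖ suc i) w (∧-fst adm)
                 g′     = monotone-elim (s ∖ suc i) w (∧-snd {usesᵇ (s ∖ suc i) w} adm)
             in ∧-intro (uses-intro s (w ++ [ x ]) (uses-snoc⇐ s w x (s≤s z≤n) j≤n (T⇒≡true (∧-fst sj∧top)) u′))
                        (monotone-intro s (w ++ [ x ])
                          (monotone-snoc⁺⇐ s w i j≤n (isTop-elim s (suc i) (∧-snd {s (suc i)} sj∧top)) u′ g′))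

  admissible-snoc⁻ : ∀ s w i → suc i ≤ n →
    admissible s (w ++ [ -[1+ i ] ]) ≡ (s (suc i) ∧ isBottom s (suc i)) ∧ admissible (s ∖ suc i) w
  admissible-snoc⁻ s w i j≤n = bool-ext to from
    where
    x = -[1+ i ]
    to : T (admissible s (w ++ [ x ])) → T ((s (suc i) ∧ isBottom s (suc i)) ∧ admissible (s ∖ suc i) w)
    to h = let u = uses-elim s (w ++ [ x ]) (∧-fst h)
               g = monotone-elim s (w ++ [ x ]) (∧-snd {usesᵇ s (w ++ [ x ])} h)
               (sj , u′) = uses-snoc⇒ s w x u (s≤s z≤n) j≤n
           in ∧-intro (∧-intro (≡true⇒T sj) (isBottom-intro s (suc i) (bottom-of-snoc s w i j≤n u g)))
                      (∧-intro (uses-intro (s ∖ suc i) w u′) (monotone-intro (s ∖ suc i) w (monotone-snoc⇒ s w x g)))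
    from : T ((s (suc i) ∧ isBottom s (suc i)) ∧ admissible (s ∖ suc i) w) → T (admissible s (w ++ [ x ]))
    from h = let sj∧bot = ∧-fst h
                 adm    = ∧-snd {s (suc i) ∧ isBottom s (suc i)} h
                 u′     = uses-elim (s ∖ suc i) w (∧-fst adm)
                 g′     = monotone-elim (s ∖ suc i) w (∧-snd {usesᵇ (s ∖ suc i) w} adm)
             in ∧-intro (uses-intro s (w ++ [ x ]) (uses-snoc⇐ s w x (s≤s z≤n) j≤n (T⇒≡true (∧-fst sj∧bot)) u′))
                        (monotone-intro s (w ++ [ x ])
                          (monotone-snoc⁻⇐ s w i j≤n (isBottom-elim s (suc i) (∧-snd {s (suc i)} sj∧bot)) u′ g′))

module Weighted (n : ℕ) (ms : List ℕ) (q : ℕ) where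
  open import Data.Integer.Base using (+_)
  open Admissible n ms

  weight : (ℕ → Bool) → List ℤ → ℕ
  weight s w = if admissible s w then q ^ ℓD w else 0

  alphabet : List ℤ
  alphabet = signedAlphabet n

  W : (ℕ → Bool) → ℕ → ℕ
  W s k = ΣL (words alphabet k) (weight s)

  ℓD-increase⁺ ℓD-increase⁻ : (ℕ → Bool) → ℕ → ℕ
  ℓD-increase⁺ s j = ΣR 0 n (λ a → if (s ∖ j) a then 𝟙 (j <ᵇ a) else 0)
  ℓD-increase⁻ s j = ΣR 0 n (λ a → if (s ∖ j) a then 1 + 𝟙 (a <ᵇ j) else 0)

  absL-InRange : ∀ w → All (Letter n) w → All (InRange n) (absL w)
  absL-InRange []      []                          = []
  absL-InRange (_ ∷ w) ((i , i<n , inj₁ refl) ∷ ls) = (s≤s z≤n , i<n) ∷ absL-InRange w ls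
  absL-InRange (_ ∷ w) ((i , i<n , inj₂ refl) ∷ ls) = (s≤s z≤n , i<n) ∷ absL-InRange w ls

  ΣL-uses : ∀ s w (h : ℕ → ℕ) → All (Letter n) w → Uses s w →
    ΣL w (λ y → h ∣ y ∣) ≡ ΣR 0 n (λ a → if s a then h a else 0)
  ΣL-uses s w h ls (d , e) =
    trans (sym (ΣL-map w ∣_∣ h)) (trans (ΣL-distinct n (absL w) h d (absL-InRange w ls))
      (ΣR-cong 0 n (λ t 1≤t t≤n → cong (λ b → if b then h t else 0) (sym (e t 1≤t t≤n)))))

  q^-+-comm : ∀ a b → q ^ (a + b) ≡ q ^ b * q ^ a
  q^-+-comm a b = trans (ℕₚ.^-distribˡ-+-* q a b) (*-comm (q ^ a) (q ^ b))

  weight-snoc⁺ : ∀ s w i → suc i ≤ n → All (Letter n) w →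
    weight s (w ++ [ + suc i ]) ≡ (if s (suc i) ∧ isTop s (suc i) then q ^ ℓD-increase⁺ s (suc i) * weight (s ∖ suc i) w else 0)
  weight-snoc⁺ s w i j≤n ls rewrite admissible-snoc⁺ s w i j≤n
    with s (suc i) ∧ isTop s (suc i) | admissible (s ∖ suc i) w in adm
  ... | false | _     = refl
  ... | true  | false = sym (*-zeroʳ (q ^ ℓD-increase⁺ s (suc i)))
  ... | true  | true  = trans (cong (q ^_) increase) (q^-+-comm (ℓD w) _)
    where
    increase : ℓD (w ++ [ + suc i ]) ≡ ℓD w + ℓD-increase⁺ s (suc i)
    increase = trans (ℓD-snoc w (+ suc i)) (cong (_+_ (ℓD w))
      (trans (ΣL-cong w (λ y _ → letterWeight⁺ (suc i) y))
             (ΣL-uses (s ∖ suc i) w (λ a → 𝟙 (suc i <ᵇ a)) ls (uses-elim (s ∖ suc i) w (∧-fst (≡true⇒T adm))))))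

  weight-snoc⁻ : ∀ s w i → suc i ≤ n → All (Letter n) w →
    weight s (w ++ [ -[1+ i ] ]) ≡ (if s (suc i) ∧ isBottom s (suc i) then q ^ ℓD-increase⁻ s (suc i) * weight (s ∖ suc i) w else 0)
  weight-snoc⁻ s w i j≤n ls rewrite admissible-snoc⁻ s w i j≤n
    with s (suc i) ∧ isBottom s (suc i) | admissible (s ∖ suc i) w in adm
  ... | false | _     = refl
  ... | true  | false = sym (*-zeroʳ (q ^ ℓD-increase⁻ s (suc i)))
  ... | true  | true  = trans (cong (q ^_) increase) (q^-+-comm (ℓD w) _)
    where
    increase : ℓD (w ++ [ -[1+ i ] ]) ≡ ℓD w + ℓD-increase⁻ s (suc i)
    increase = trans (ℓD-snoc w -[1+ i ]) (cong (_+_ (ℓD w))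
      (trans (ΣL-cong w (λ y _ → letterWeight⁻ i y))
             (ΣL-uses (s ∖ suc i) w (λ a → 1 + 𝟙 (a <ᵇ suc i)) ls (uses-elim (s ∖ suc i) w (∧-fst (≡true⇒T adm))))))

  term⁺ term⁻ : (ℕ → Bool) → ℕ → ℕ → ℕ
  term⁺ s k t = if s t ∧ isTop s t    then q ^ ℓD-increase⁺ s t * W (s ∖ t) k else 0
  term⁻ s k t = if s t ∧ isBottom s t then q ^ ℓD-increase⁻ s t * W (s ∖ t) k else 0

  W-step : ∀ s k → W s (suc k) ≡ ΣR 0 n (term⁻ s k) + ΣR 0 n (term⁺ s k)
  W-step s k = begin
    W s (suc k)
      ≡⟨ words-snoc alphabet k (weight s) ⟩
    ΣL (words alphabet k) (λ w → ΣL alphabet (λ x → weight s (w ++ [ x ])))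
      ≡⟨ words-cong (Letter n) alphabet (alphabet-Letter n) k (λ w ls _ → by-letter w ls) ⟩
    ΣL (words alphabet k) (λ w → ΣR 0 n (λ t → weight⁻ t w) + ΣR 0 n (λ t → weight⁺ t w))
      ≡⟨ ΣL-+ (words alphabet k) _ _ ⟩
    ΣL (words alphabet k) (λ w → ΣR 0 n (λ t → weight⁻ t w)) + ΣL (words alphabet k) (λ w → ΣR 0 n (λ t → weight⁺ t w))
      ≡⟨ cong₂ _+_ (trans (ΣL-ΣR (words alphabet k) 0 n (λ w t → weight⁻ t w))
                          (ΣR-cong 0 n (λ t _ _ → ΣL-if (words alphabet k) (s t ∧ isBottom s t) (q ^ ℓD-increase⁻ s t) (weight (s ∖ t)))))
                   (trans (ΣL-ΣR (words alphabet k) 0 n (λ w t → weight⁺ t w))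
                          (ΣR-cong 0 n (λ t _ _ → ΣL-if (words alphabet k) (s t ∧ isTop s t) (q ^ ℓD-increase⁺ s t) (weight (s ∖ t))))) ⟩
    ΣR 0 n (term⁻ s k) + ΣR 0 n (term⁺ s k) ∎
    where
    open ≡-Reasoning
    weight⁺ weight⁻ : ℕ → List ℤ → ℕ
    weight⁺ t w = if s t ∧ isTop s t    then q ^ ℓD-increase⁺ s t * weight (s ∖ t) w else 0
    weight⁻ t w = if s t ∧ isBottom s t then q ^ ℓD-increase⁻ s t * weight (s ∖ t) w else 0
    by-letter : ∀ w → All (Letter n) w →
      ΣL alphabet (λ x → weight s (w ++ [ x ])) ≡ ΣR 0 n (λ t → weight⁻ t w) + ΣR 0 n (λ t → weight⁺ t w)
    by-letter w ls = trans (ΣL-alphabet n (λ x → weight s (w ++ [ x ])))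
      (cong₂ _+_ (ΣR-cong 0 n (λ { (suc i) _ j≤n → weight-snoc⁻ s w i j≤n ls }))
                 (ΣR-cong 0 n (λ { (suc i) _ j≤n → weight-snoc⁺ s w i j≤n ls })))

Empty : (ℕ → Bool) → ℕ → ℕ → Set
Empty p lo hi = ∀ t → lo < t → t ≤ hi → ¬ T (p t)

≤-suc⇒≤⊎≡ : ∀ {a h} → a ≤ suc h → a ≤ h ⊎ a ≡ suc h
≤-suc⇒≤⊎≡ a≤h+1 with ℕₚ.m≤n⇒m<n∨m≡n a≤h+1
... | inj₁ a<h+1 = inj₁ (≤-pred a<h+1)
... | inj₂ a≡h+1 = inj₂ a≡h+1

greatest : ∀ (p : ℕ → Bool) lo hi → Empty p lo hi ⊎
  Σ ℕ (λ t → lo < t × t ≤ hi × T (p t) × (∀ a → t < a → a ≤ hi → ¬ T (p a)))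
greatest p lo zero    = inj₁ (λ t lo<t t≤0 _ → <⇒≱ (≤-<-trans z≤n lo<t) t≤0)
greatest p lo (suc h) with lo ℕ.<? suc h
... | no lo≮h+1 = inj₁ (λ t lo<t t≤h+1 _ → lo≮h+1 (<-≤-trans lo<t t≤h+1))
... | yes lo<h+1 with p (suc h) in eq | greatest p lo h
...   | true  | _         = inj₂ (suc h , lo<h+1 , ≤-refl , ≡true⇒T eq , λ a h+1<a a≤h+1 _ → <⇒≱ h+1<a a≤h+1)
...   | false | inj₁ none = inj₁ (λ t lo<t t≤h+1 → [ none t lo<t , (λ { refl → subst T eq }) ]′ (≤-suc⇒≤⊎≡ t≤h+1))
...   | false | inj₂ (t , lo<t , t≤h , pt , above) =
  inj₂ (t , lo<t , ℕₚ.m≤n⇒m≤1+n t≤h , pt , λ a t<a a≤h+1 → [ above a t<a , (λ { refl → subst T eq }) ]′ (≤-suc⇒≤⊎≡ a≤h+1))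

least : ∀ (p : ℕ → Bool) lo hi → Empty p lo hi ⊎
  Σ ℕ (λ t → lo < t × t ≤ hi × T (p t) × (∀ a → lo < a → a < t → ¬ T (p a)))
least p lo zero    = inj₁ (λ t lo<t t≤0 _ → <⇒≱ (≤-<-trans z≤n lo<t) t≤0)
least p lo (suc h) with least p lo h
... | inj₂ (t , lo<t , t≤h , pt , below) = inj₂ (t , lo<t , ℕₚ.m≤n⇒m≤1+n t≤h , pt , below)
... | inj₁ none with lo ℕ.<? suc h | p (suc h) in eq
...   | yes lo<h+1 | true  = inj₂ (suc h , lo<h+1 , ≤-refl , ≡true⇒T eq , λ a lo<a a<h+1 → none a lo<a (≤-pred a<h+1))
...   | yes _      | false = inj₁ (λ t lo<t t≤h+1 → [ none t lo<t , (λ { refl → subst T eq }) ]′ (≤-suc⇒≤⊎≡ t≤h+1))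
...   | no lo≮h+1  | _     = inj₁ (λ t lo<t t≤h+1 _ → lo≮h+1 (<-≤-trans lo<t t≤h+1))

ΣI-single : ∀ lo hi (c : ℕ → Bool) (F : ℕ → ℕ) t₀ → lo < t₀ → t₀ ≤ hi → T (c t₀) →
  (∀ t → lo < t → t ≤ hi → T (c t) → t ≡ t₀) → ΣI lo hi (λ t → if c t then F t else 0) ≡ F t₀
ΣI-single lo hi c F t₀ lo<t₀ t₀≤hi ct₀ unique =
  trans (ΣI-cong lo hi (λ t lo<t t≤hi → cong (λ b → if b then F t else 0) (only-t₀ t lo<t t≤hi)))
        (ΣR-delta lo (hi ∸ lo) t₀ F lo<t₀ (≤-trans t₀≤hi (≤-reflexive (sym (ℕₚ.m+[n∸m]≡n lo≤hi)))))
  where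
  lo≤hi : lo ≤ hi
  lo≤hi = <⇒≤ (<-≤-trans lo<t₀ t₀≤hi)
  only-t₀ : ∀ t → lo < t → t ≤ hi → c t ≡ (t ≡ᵇ t₀)
  only-t₀ t lo<t t≤hi = bool-ext (λ ct → ℕₚ.≡⇒≡ᵇ t t₀ (unique t lo<t t≤hi ct))
                                 (λ e → subst (T ∘ c) (sym (ℕₚ.≡ᵇ⇒≡ t t₀ e)) ct₀)

greatest-unique : ∀ (p : ℕ → Bool) hi t t₀ → T (p t) → T (p t₀) → t ≤ hi → t₀ ≤ hi →
  (∀ a → t < a → a ≤ hi → ¬ T (p a)) → (∀ a → t₀ < a → a ≤ hi → ¬ T (p a)) → t ≡ t₀
greatest-unique p hi t t₀ pt pt₀ t≤hi t₀≤hi above above₀ with ℕₚ.<-cmp t t₀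
... | tri< t<t₀ _ _ = ⊥-elim (above t₀ t<t₀ t₀≤hi pt₀)
... | tri≈ _ t≡t₀ _ = t≡t₀
... | tri> _ _ t₀<t = ⊥-elim (above₀ t t₀<t t≤hi pt)

least-unique : ∀ (p : ℕ → Bool) lo t t₀ → T (p t) → T (p t₀) → lo < t → lo < t₀ →
  (∀ a → lo < a → a < t → ¬ T (p a)) → (∀ a → lo < a → a < t₀ → ¬ T (p a)) → t ≡ t₀
least-unique p lo t t₀ pt pt₀ lo<t lo<t₀ below below₀ with ℕₚ.<-cmp t t₀
... | tri< t<t₀ _ _ = ⊥-elim (below₀ t lo<t t<t₀ pt)
... | tri≈ _ t≡t₀ _ = t≡t₀
... | tri> _ _ t₀<t = ⊥-elim (below t₀ lo<t₀ t₀<t pt₀)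

-- The sorted cuts 0 ≤ m₁ ≤ ⋯ ≤ m_t ≤ n cut (0,n] into the blocks
-- (0,m₁], (m₁,m₂], …, (m_t,n], listed by `blocks 0 ms`.  Inside a block
-- (lo,hi], j is the top of s exactly when no element of s lies in (j,hi],
-- and (for blocks other than the first) the bottom exactly when none lies in
-- (lo,j).  In the first block nothing is a bottom, because 0 ∈ s.
module Blocks (n : ℕ) (ms : List ℕ) where
  open Admissible n ms
  open import Data.Bool.ListAction using (any)
  open import Data.List.Relation.Unary.Any.Properties using (any⁺; any⁻)
  open import Data.List.Membership.Propositional using (find; lose)

  noCut-intro : ∀ a b → (∀ m → m ∈ ms → a ≤ m → m < b → ⊥) → T (noCut a b)
  noCut-intro a b h = not-intro (λ t → let (m , m∈ , am<b) = find (any⁻ _ ms t)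
    in h m m∈ (ℕₚ.≤ᵇ⇒≤ a m (∧-fst am<b)) (ℕₚ.<ᵇ⇒< m b (∧-snd {a ≤ᵇ m} am<b)))

  noCut-elim : ∀ a b m → m ∈ ms → a ≤ m → m < b → ¬ T (noCut a b)
  noCut-elim a b m m∈ a≤m m<b h = not-elim h (any⁺ _ (lose m∈ (∧-intro (ℕₚ.≤⇒≤ᵇ a≤m) (ℕₚ.<⇒<ᵇ m<b))))

  Sorted : ℕ → List ℕ → Set
  Sorted lo []      = lo ≤ n
  Sorted lo (m ∷ r) = lo ≤ m × Sorted m r

  Sorted-≤n : ∀ lo r → Sorted lo r → lo ≤ n
  Sorted-≤n lo []      p       = p
  Sorted-≤n lo (m ∷ r) (lo≤m , sorted′) = ≤-trans lo≤m (Sorted-≤n m r sorted′)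

  Sorted-lower : ∀ lo r → Sorted lo r → ∀ m → m ∈ r → lo ≤ m
  Sorted-lower lo (m ∷ r) (lo≤m , sorted′) .m (here refl) = lo≤m
  Sorted-lower lo (m ∷ r) (lo≤m , sorted′) x  (there x∈)  = ≤-trans lo≤m (Sorted-lower m r sorted′ x x∈)

  blocks : ℕ → List ℕ → List (ℕ × ℕ)
  blocks lo []      = (lo , n) ∷ []
  blocks lo (m ∷ r) = (lo , m) ∷ blocks m r

  blocks-lower : ∀ lo r → Sorted lo r → ∀ b → b ∈ blocks lo r → lo ≤ proj₁ b
  blocks-lower lo []      _       .(lo , n) (here refl) = ≤-refl
  blocks-lower lo (m ∷ r) _       .(lo , m) (here refl) = ≤-refl
  blocks-lower lo (m ∷ r) (lo≤m , sorted′) b         (there b∈)  = ≤-trans lo≤m (blocks-lower m r sorted′ b b∈)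

  blocks-≤n : ∀ lo r → Sorted lo r → ∀ b → b ∈ blocks lo r → proj₂ b ≤ n
  blocks-≤n lo []      _       .(lo , n) (here refl) = ≤-refl
  blocks-≤n lo (m ∷ r) (lo≤m , sorted′) .(lo , m) (here refl) = Sorted-≤n m r sorted′
  blocks-≤n lo (m ∷ r) (lo≤m , sorted′) b         (there b∈)  = blocks-≤n m r sorted′ b b∈

  ΣI-blocks : ∀ F lo r → Sorted lo r → ΣI lo n F ≡ ΣL (blocks lo r) (λ b → ΣI (proj₁ b) (proj₂ b) F)
  ΣI-blocks F lo []      _       = sym (+-identityʳ _)
  ΣI-blocks F lo (m ∷ r) (lo≤m , sorted′) = trans (ΣI-split lo m n F lo≤m (Sorted-≤n m r sorted′)) (cong (ΣI lo m F +_) (ΣI-blocks F m r sorted′))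

  record Block (lo hi : ℕ) : Set where
    field
      lo≤hi     : lo ≤ hi
      hi≤n      : hi ≤ n
      separated : ∀ m → m ∈ ms → m ≤ lo ⊎ hi ≤ m
      top-cut   : hi < n → hi ∈ ms

  blocks-Block : ∀ lo r → Sorted lo r → (∀ m → m ∈ r → m ∈ ms) → (∀ m → m ∈ ms → m ≤ lo ⊎ m ∈ r) →
    ∀ b → b ∈ blocks lo r → Block (proj₁ b) (proj₂ b)
  blocks-Block lo [] lo≤n _ cuts .(lo , n) (here refl) = record
    { lo≤hi = lo≤n ; hi≤n = ≤-refl ; separated = λ m m∈ → sep m (cuts m m∈)
    ; top-cut = λ n<n → ⊥-elim (ℕₚ.<-irrefl refl n<n) }
    where
    sep : ∀ m → m ≤ lo ⊎ m ∈ [] → m ≤ lo ⊎ n ≤ m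
    sep m (inj₁ m≤lo) = inj₁ m≤lo
  blocks-Block lo (m₁ ∷ r) (lo≤m , sorted′) r⊆ cuts .(lo , m₁) (here refl) = record
    { lo≤hi = lo≤m ; hi≤n = Sorted-≤n m₁ r sorted′ ; separated = λ m m∈ → sep m (cuts m m∈)
    ; top-cut = λ _ → r⊆ m₁ (here refl) }
    where
    sep : ∀ m → m ≤ lo ⊎ m ∈ (m₁ ∷ r) → m ≤ lo ⊎ m₁ ≤ m
    sep m (inj₁ m≤lo)        = inj₁ m≤lo
    sep m (inj₂ (here refl)) = inj₂ ≤-refl
    sep m (inj₂ (there m∈r)) = inj₂ (Sorted-lower m₁ r sorted′ m m∈r)
  blocks-Block lo (m₁ ∷ r) (lo≤m , sorted′) r⊆ cuts b (there b∈) =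
    blocks-Block m₁ r sorted′ (λ m m∈ → r⊆ m (there m∈)) (λ m m∈ → sep m (cuts m m∈)) b b∈
    where
    sep : ∀ m → m ≤ lo ⊎ m ∈ (m₁ ∷ r) → m ≤ m₁ ⊎ m ∈ r
    sep m (inj₁ m≤lo)        = inj₁ (≤-trans m≤lo lo≤m)
    sep m (inj₂ (here refl)) = inj₁ ≤-refl
    sep m (inj₂ (there m∈r)) = inj₂ m∈r

  blocks-lower-cut : ∀ lo r b → b ∈ blocks lo r → proj₁ b ∈ lo ∷ r
  blocks-lower-cut lo []      .(lo , n) (here refl) = here refl
  blocks-lower-cut lo (m ∷ r) .(lo , m) (here refl) = here refl
  blocks-lower-cut lo (m ∷ r) b         (there b∈)  = there (blocks-lower-cut m r b b∈)

  module _ (s : ℕ → Bool) (lo hi t : ℕ) (hi≤n : hi ≤ n) (sep : ∀ m → m ∈ ms → m ≤ lo ⊎ hi ≤ m)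
           (lo<t : lo < t) (t≤hi : t ≤ hi) where

    cut-outside : ∀ {a b m} → m ≤ lo ⊎ hi ≤ m → lo < a → a ≤ m → m < b → b ≤ hi → ⊥
    cut-outside (inj₁ m≤lo) lo<a a≤m _   _    = <⇒≱ lo<a (≤-trans a≤m m≤lo)
    cut-outside (inj₂ hi≤m) _    _   m<b b≤hi = <⇒≱ m<b (≤-trans b≤hi hi≤m)

    noCut-inside : ∀ a b → lo < a → b ≤ hi → T (noCut a b)
    noCut-inside a b lo<a b≤hi = noCut-intro a b (λ m m∈ a≤m m<b → cut-outside (sep m m∈) lo<a a≤m m<b b≤hi)

    top⇒above : TopOf s t → ∀ a → t < a → a ≤ hi → ¬ T (s a)
    top⇒above top a t<a a≤hi sa = top a (≤-trans a≤hi hi≤n) sa t<a (noCut-inside t a lo<t a≤hi)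

    above⇒top : (hi < n → hi ∈ ms) → (∀ a → t < a → a ≤ hi → ¬ T (s a)) → TopOf s t
    above⇒top top-cut above t′ t′≤n st′ t<t′ nc with t′ ℕₚ.≤? hi
    ... | yes t′≤hi = above t′ t<t′ t′≤hi st′
    ... | no  t′≰hi = noCut-elim t t′ hi (top-cut (<-≤-trans (ℕₚ.≰⇒> t′≰hi) t′≤n)) t≤hi (ℕₚ.≰⇒> t′≰hi) nc

    bottom⇒below : BottomOf s t → ∀ a → lo < a → a < t → ¬ T (s a)
    bottom⇒below bot a lo<a a<t sa = bot a (≤-trans (<⇒≤ a<t) (≤-trans t≤hi hi≤n)) sa a<t (noCut-inside a t lo<a t≤hi)

    below⇒bottom : lo ∈ ms → (∀ a → lo < a → a < t → ¬ T (s a)) → BottomOf s t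
    below⇒bottom lo∈ below a a≤n sa a<t nc with lo ℕ.<? a
    ... | yes lo<a = below a lo<a a<t sa
    ... | no  lo≮a = noCut-elim a t lo lo∈ (ℕₚ.≮⇒≥ lo≮a) lo<t nc

  no-bottom-in-first : ∀ s h t → T (s 0) → (∀ m → m ∈ ms → h ≤ m) → 0 < t → t ≤ h → ¬ BottomOf s t
  no-bottom-in-first s h t s0 below-cuts 0<t t≤h bot =
    bot 0 z≤n s0 0<t (noCut-intro 0 t (λ m m∈ _ m<t → <⇒≱ m<t (≤-trans t≤h (below-cuts m m∈))))

module QArithmetic (q : ℕ) where
  open import Data.List using (_∷ʳ_)
  open import Data.List.Properties using (map-upTo; applyUpTo-∷ʳ)
  open import Data.Nat.ListAction.Properties using (product-++)

  qint-ΣR : ∀ k → qint q k ≡ ΣR 0 k (λ t → q ^ pred t)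
  qint-ΣR k = ΣL-applyUpTo k (λ i → i) (q ^_)

  qint-+ : ∀ a b → qint q (a + b) ≡ qint q a + q ^ a * qint q b
  qint-+ a b = begin
    qint q (a + b)                                                ≡⟨ qint-ΣR (a + b) ⟩
    ΣR 0 (a + b) (λ t → q ^ pred t)                               ≡⟨ ΣR-split 0 a b _ ⟩
    ΣR 0 a (λ t → q ^ pred t) + ΣR a b (λ t → q ^ pred t)         ≡⟨ cong₂ _+_ (sym (qint-ΣR a)) (ΣR-from0 a b _) ⟩
    qint q a + ΣR 0 b (λ t → q ^ pred (a + t))                    ≡⟨ cong (qint q a +_) (ΣR-cong 0 b shift) ⟩
    qint q a + ΣR 0 b (λ t → q ^ a * q ^ pred t)                  ≡⟨ cong (qint q a +_) (ΣR-* 0 b (q ^ a) _) ⟩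
    qint q a + q ^ a * ΣR 0 b (λ t → q ^ pred t)                  ≡⟨ cong (λ z → qint q a + q ^ a * z) (sym (qint-ΣR b)) ⟩
    qint q a + q ^ a * qint q b                                   ∎
    where
    open ≡-Reasoning
    shift : ∀ t → 0 < t → t ≤ b → q ^ pred (a + t) ≡ q ^ a * q ^ pred t
    shift (suc t) _ _ = trans (cong (λ z → q ^ pred z) (+-suc a t)) (ℕₚ.^-distribˡ-+-* q a t)

  qint-+′ : ∀ a b → qint q (a + b) ≡ qint q b + q ^ b * qint q a
  qint-+′ a b = trans (cong (qint q) (+-comm a b)) (qint-+ b a)

  prodRange-applyUpTo : ∀ a b f → prodRange a b f ≡ product (applyUpTo (λ i → f (a + i)) (b ∸ a))
  prodRange-applyUpTo a b f = cong product (map-upTo (λ i → f (a + i)) (b ∸ a))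

  prodRange-empty : ∀ a b f → b ≤ a → prodRange a b f ≡ 1
  prodRange-empty a b f b≤a = trans (prodRange-applyUpTo a b f) (cong (λ d → product (applyUpTo (λ i → f (a + i)) d)) (ℕₚ.m≤n⇒m∸n≡0 b≤a))

  prodRange-snoc : ∀ a b f → a ≤ b → prodRange a (suc b) f ≡ prodRange a b f * f b
  prodRange-snoc a b f a≤b = begin
    prodRange a (suc b) f                                         ≡⟨ prodRange-applyUpTo a (suc b) f ⟩
    product (applyUpTo g (suc b ∸ a))                             ≡⟨ cong (λ d → product (applyUpTo g d)) (ℕₚ.+-∸-assoc 1 a≤b) ⟩
    product (applyUpTo g (suc (b ∸ a)))                           ≡⟨ cong product (sym (applyUpTo-∷ʳ g (b ∸ a))) ⟩
    product (applyUpTo g (b ∸ a) ∷ʳ g (b ∸ a))                    ≡⟨ product-++ (applyUpTo g (b ∸ a)) [ g (b ∸ a) ] ⟩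
    product (applyUpTo g (b ∸ a)) * (g (b ∸ a) * 1)               ≡⟨ cong (product (applyUpTo g (b ∸ a)) *_) (*-identityʳ _) ⟩
    product (applyUpTo g (b ∸ a)) * g (b ∸ a)                     ≡⟨ cong₂ _*_ (sym (prodRange-applyUpTo a b f)) (cong f (ℕₚ.m+[n∸m]≡n a≤b)) ⟩
    prodRange a b f * f b                                         ∎
    where
    open ≡-Reasoning
    g : ℕ → ℕ
    g i = f (a + i)

  prodRange-cons : ∀ a b f → a < b → prodRange a b f ≡ f a * prodRange (suc a) b f
  prodRange-cons a b f a<b = begin
    prodRange a b f                                               ≡⟨ prodRange-applyUpTo a b f ⟩
    product (applyUpTo (λ i → f (a + i)) (b ∸ a))                 ≡⟨ cong (λ d → product (applyUpTo (λ i → f (a + i)) d)) (ℕₚ.+-∸-assoc 1 a<b) ⟩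
    f (a + 0) * product (applyUpTo (λ i → f (a + suc i)) (b ∸ suc a))
      ≡⟨ cong₂ _*_ (cong f (+-identityʳ a)) (cong product (applyUpTo-cong (b ∸ suc a) (λ i → cong f (+-suc a i)))) ⟩
    f a * product (applyUpTo (λ i → f (suc a + i)) (b ∸ suc a))   ≡⟨ cong (f a *_) (sym (prodRange-applyUpTo (suc a) b f)) ⟩
    f a * prodRange (suc a) b f                                   ∎
    where
    open ≡-Reasoning
    applyUpTo-cong : ∀ d {g h : ℕ → ℕ} → (∀ i → g i ≡ h i) → applyUpTo g d ≡ applyUpTo h d
    applyUpTo-cong zero    e = refl
    applyUpTo-cong (suc d) e = cong₂ _∷_ (e 0) (applyUpTo-cong d (λ i → e (suc i)))

  fq : ℕ → ℕ
  fq i = 1 + q ^ i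

  step-identity : ∀ c₀ S k → c₀ + S ≡ suc k →
    qint q c₀ * q ^ S * prodRange (pred c₀) k fq + qint q S * prodRange c₀ k fq + q ^ k * q ^ c₀ * qint q S * prodRange c₀ k fq
    ≡ qint q (suc k) * prodRange c₀ (suc k) fq
  step-identity zero (suc S) .S refl = begin
    0 * q ^ suc S * Y + [S+1] * Y + q ^ S * 1 * [S+1] * Y      ≡⟨ ring (q ^ suc S) Y [S+1] (q ^ S) ⟩
    [S+1] * (Y * (1 + q ^ S))                              ≡⟨ cong ([S+1] *_) (sym (prodRange-snoc 0 S fq z≤n)) ⟩
    [S+1] * prodRange 0 (suc S) fq                         ∎
    where
    open ≡-Reasoning
    Y = prodRange 0 S fq
    [S+1] = qint q (suc S)
    ring : ∀ a y b z → 0 * a * y + b * y + z * 1 * b * y ≡ b * (y * (1 + z))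
    ring = solve-∀
  step-identity (suc c) zero k e with trans (sym (+-identityʳ (suc c))) e
  ... | refl = begin
    [c+1] * 1 * prodRange c c fq + 0 * prodRange (suc c) c fq + z * 0 * prodRange (suc c) c fq
      ≡⟨ cong₂ (λ u v → [c+1] * 1 * u + 0 * v + z * 0 * v) (prodRange-empty c c fq ≤-refl) (prodRange-empty (suc c) c fq (ℕₚ.n≤1+n c)) ⟩
    [c+1] * 1 * 1 + 0 * 1 + z * 0 * 1    ≡⟨ ring [c+1] z ⟩
    [c+1] * 1                            ≡⟨ cong ([c+1] *_) (sym (prodRange-empty (suc c) (suc c) fq ≤-refl)) ⟩
    [c+1] * prodRange (suc c) (suc c) fq ∎
    where
    open ≡-Reasoning
    [c+1] = qint q (suc c)
    z = q ^ c * q ^ suc c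
    ring : ∀ a z → a * 1 * 1 + 0 * 1 + z * 0 * 1 ≡ a * 1
    ring = solve-∀
  step-identity (suc c) (suc S) k e = begin
    [c+1] * a * prodRange c k fq + [S+1] * Y + q ^ k * (q * b) * [S+1] * Y
      ≡⟨ cong₂ (λ u v → [c+1] * a * u + [S+1] * Y + v * (q * b) * [S+1] * Y) (prodRange-cons c k fq c<k) q^k ⟩
    [c+1] * a * ((1 + b) * Y) + [S+1] * Y + b * a * (q * b) * [S+1] * Y
      ≡⟨ expand [c+1] [S+1] a b Y q ⟩
    Y * ([S+1] + a * [c+1]) + Y * b * a * ([c+1] + q * b * [S+1])
      ≡⟨ cong (λ z → Y * ([S+1] + a * [c+1]) + Y * b * a * z) pascal ⟩
    Y * ([S+1] + a * [c+1]) + Y * b * a * ([S+1] + a * [c+1])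
      ≡⟨ collect [c+1] [S+1] a b Y ⟩
    ([S+1] + a * [c+1]) * (Y * (1 + b * a))
      ≡⟨ cong₂ _*_ (sym [k+1]-split) (sym (trans (prodRange-snoc (suc c) k fq c<k) (cong (λ z → Y * (1 + z)) q^k))) ⟩
    qint q (suc k) * prodRange (suc c) (suc k) fq ∎
    where
    open ≡-Reasoning
    [c+1] = qint q (suc c)
    [S+1] = qint q (suc S)
    a = q ^ suc S
    b = q ^ c
    Y = prodRange (suc c) k fq
    k≡ : k ≡ c + suc S
    k≡ = ℕₚ.suc-injective (sym e)
    c<k : c < k
    c<k = subst (c <_) (sym k≡) (≤-trans (s≤s (ℕₚ.m≤m+n c S)) (≤-reflexive (sym (+-suc c S))))
    q^k : q ^ k ≡ b * a
    q^k = trans (cong (q ^_) k≡) (ℕₚ.^-distribˡ-+-* q c (suc S))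
    [k+1]-split : qint q (suc k) ≡ [S+1] + a * [c+1]
    [k+1]-split = trans (cong (qint q) (sym e)) (qint-+′ (suc c) (suc S))
    pascal : [c+1] + q * b * [S+1] ≡ [S+1] + a * [c+1]
    pascal = trans (sym (qint-+ (suc c) (suc S))) (trans (cong (qint q) e) [k+1]-split)
    expand : ∀ A B a b Y q → A * a * ((1 + b) * Y) + B * Y + b * a * (q * b) * B * Y ≡ Y * (B + a * A) + Y * b * a * (A + q * b * B)
    expand = solve-∀
    collect : ∀ A B a b Y → Y * (B + a * A) + Y * b * a * (B + a * A) ≡ (B + a * A) * (Y * (1 + b * a))
    collect = solve-∀

  qbinom : ℕ → ℕ → ℕ
  qbinom zero    b       = 1
  qbinom (suc a) zero    = 1
  qbinom (suc a) (suc b) = qbinom a (suc b) + q ^ suc a * qbinom (suc a) b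

  qbinom-qfact : ∀ a b → qbinom a b * qfact q a * qfact q b ≡ qfact q (a + b)
  qbinom-qfact zero    b    = +-identityʳ (qfact q b)
  qbinom-qfact (suc a) zero = trans (*-identityʳ (1 * qfact q (suc a))) (trans (ℕₚ.*-identityˡ _) (cong (qfact q) (sym (+-identityʳ (suc a)))))
  qbinom-qfact (suc a) (suc b) = begin
    (X + P * Z) * ([a+1] * F) * ([b+1] * G)              ≡⟨ rearrange X Z P [a+1] F [b+1] G ⟩
    X * F * ([b+1] * G) * [a+1] + P * [b+1] * (Z * ([a+1] * F) * G)
      ≡⟨ cong₂ (λ u v → u * [a+1] + P * [b+1] * v) (qbinom-qfact a (suc b)) (trans (qbinom-qfact (suc a) b) (cong (qfact q) (sym (+-suc a b)))) ⟩
    N * [a+1] + P * [b+1] * N                            ≡⟨ factor N [a+1] P [b+1] ⟩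
    ([a+1] + P * [b+1]) * N                              ≡⟨ cong (_* N) (sym (qint-+ (suc a) (suc b))) ⟩
    qint q (suc a + suc b) * N                   ∎
    where
    open ≡-Reasoning
    X = qbinom a (suc b)
    Z = qbinom (suc a) b
    P = q ^ suc a
    [a+1] = qint q (suc a)
    F = qfact q a
    [b+1] = qint q (suc b)
    G = qfact q b
    N = qfact q (a + suc b)
    rearrange : ∀ X Z P A F B G → (X + P * Z) * (A * F) * (B * G) ≡ X * F * (B * G) * A + P * B * (Z * (A * F) * G)
    rearrange = solve-∀
    factor : ∀ N A P B → N * A + P * B * N ≡ (A + P * B) * N
    factor = solve-∀

  -- [Σ cs]! is divisible by ∏ [c]!, so q-multinomial coefficients are integers.
  qmultinomial-integral : ∀ cs → Σ ℕ (λ G → G * product (map (qfact q) cs) ≡ qfact q (sum cs))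
  qmultinomial-integral []       = 1 , refl
  qmultinomial-integral (c ∷ cs) =
    let (G , eq) = qmultinomial-integral cs
    in qbinom c (sum cs) * G ,
       trans (rearrange (qbinom c (sum cs)) G (qfact q c) (product (map (qfact q) cs)))
             (trans (cong (qbinom c (sum cs) * qfact q c *_) eq) (qbinom-qfact c (sum cs)))
    where
    rearrange : ∀ Q G F P → Q * G * (F * P) ≡ Q * F * (G * P)
    rearrange = solve-∀

  divide-out : ∀ W N Π G D .{{_ : NonZero D}} → G * D ≡ N → W * D ≡ N * Π → W ≡ (N / D) * Π
  divide-out W N Π G D G·D≡N W·D≡N·Π = begin
    W             ≡⟨ ℕₚ.*-cancelʳ-≡ W (G * Π) D (trans W·D≡N·Π (trans (cong (_* Π) (sym G·D≡N)) (rearrange G D Π))) ⟩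
    G * Π         ≡⟨ cong (_* Π) (sym (trans (cong (_/ D) (sym G·D≡N)) (m*n/n≡m G D))) ⟩
    (N / D) * Π   ∎
    where
    open ≡-Reasoning
    rearrange : ∀ g d p → g * d * p ≡ g * p * d
    rearrange = solve-∀

-- For a value set s containing 0 with k elements in
-- [1,n], write c_b for the number of its elements in block b, c₀ for the
-- first block, and D s = ∏_b [c_b]_q!.  Then
--     W s k · D s = [k]_q! · ∏_{i=c₀}^{k-1} (1+q^i),
-- by induction on k using W-step: in each block only the top contributes a
-- +letter term and (outside the first block) only the bottom a -letter term;
-- removing it divides D s by [c_b], and the resulting sums over blocks
-- telescope to q-integers, leaving the identity `step-identity`.
module Induction (n : ℕ) (ms : List ℕ) (q : ℕ) where
  open Admissible n ms
  open Weighted n ms q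
  open Blocks n ms
  open QArithmetic q

  count : (ℕ → Bool) → ℕ → ℕ → ℕ
  count s a b = ΣI a b (𝟙 ∘ s)

  count-zero : ∀ s a b → Empty s a b → count s a b ≡ 0
  count-zero s a b none = ΣI-zero a b _ (λ t a<t t≤b → cong 𝟙 (¬T⇒≡false (none t a<t t≤b)))

  count-∖-outside : ∀ s t a b → (∀ x → a < x → x ≤ b → x ≢ t) → count (s ∖ t) a b ≡ count s a b
  count-∖-outside s t a b h = ΣI-cong a b (λ x a<x x≤b → cong 𝟙 (∖-other s t x (h x a<x x≤b)))

  count-∖-inside : ∀ s t a b → a < t → t ≤ b → T (s t) → count s a b ≡ suc (count (s ∖ t) a b)
  count-∖-inside s t a b a<t t≤b st = begin
    ΣI a b (𝟙 ∘ s)                                  ≡⟨ ΣI-cong a b (λ x _ _ → split x) ⟩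
    ΣI a b (λ x → 𝟙 ((s ∖ t) x) + 𝟙 (x ≡ᵇ t))       ≡⟨ ΣR-+ a (b ∸ a) _ _ ⟩
    count (s ∖ t) a b + ΣI a b (λ x → 𝟙 (x ≡ᵇ t))   ≡⟨ cong (count (s ∖ t) a b +_) (ΣR-delta a (b ∸ a) t (λ _ → 1) a<t t≤a+[b∸a]) ⟩
    count (s ∖ t) a b + 1                           ≡⟨ +-comm _ 1 ⟩
    suc (count (s ∖ t) a b)                         ∎
    where
    open ≡-Reasoning
    t≤a+[b∸a] : t ≤ a + (b ∸ a)
    t≤a+[b∸a] = ≤-trans t≤b (≤-reflexive (sym (ℕₚ.m+[n∸m]≡n (≤-trans (<⇒≤ a<t) t≤b))))
    split : ∀ x → 𝟙 (s x) ≡ 𝟙 ((s ∖ t) x) + 𝟙 (x ≡ᵇ t)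
    split x with x ℕ.≟ t
    ... | yes refl = trans (cong 𝟙 (T⇒≡true st)) (sym (cong₂ (λ u v → 𝟙 u + 𝟙 v) (∖-self s x) (≡ᵇ-refl x)))
    ... | no ne    = trans (cong 𝟙 (sym (∖-other s t x ne)))
                           (sym (trans (cong (λ v → 𝟙 ((s ∖ t) x) + 𝟙 v) (≡ᵇ-≢ x t ne)) (+-identityʳ _)))

  blockFactorials : (ℕ → Bool) → List (ℕ × ℕ) → ℕ
  blockFactorials s L = product (map (λ b → qfact q (count s (proj₁ b) (proj₂ b))) L)

  D : (ℕ → Bool) → ℕ
  D s = blockFactorials s (blocks 0 ms)

  blockFactorials-∖-outside : ∀ s t L → (∀ b → b ∈ L → ∀ x → proj₁ b < x → x ≤ proj₂ b → x ≢ t) →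
    blockFactorials (s ∖ t) L ≡ blockFactorials s L
  blockFactorials-∖-outside s t []      h = refl
  blockFactorials-∖-outside s t (b ∷ L) h =
    cong₂ _*_ (cong (qfact q) (count-∖-outside s t (proj₁ b) (proj₂ b) (h b (here refl))))
              (blockFactorials-∖-outside s t L (λ b′ b′∈ → h b′ (there b′∈)))

  blockFactorials-∖ : ∀ s t lo r → Sorted lo r → ∀ b → b ∈ blocks lo r → proj₁ b < t → t ≤ proj₂ b → T (s t) →
    blockFactorials s (blocks lo r) ≡ qint q (count s (proj₁ b) (proj₂ b)) * blockFactorials (s ∖ t) (blocks lo r)
  blockFactorials-∖ s t lo [] _ .(lo , n) (here refl) lo<t t≤n st rewrite count-∖-inside s t lo n lo<t t≤n st =
    *-assoc (qint q (suc (count (s ∖ t) lo n))) (qfact q (count (s ∖ t) lo n)) 1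
  blockFactorials-∖ s t lo (m ∷ r) (_ , sorted) .(lo , m) (here refl) lo<t t≤m st rewrite count-∖-inside s t lo m lo<t t≤m st =
    trans (cong (qfact q (suc (count (s ∖ t) lo m)) *_) (sym (blockFactorials-∖-outside s t (blocks m r) later)))
          (*-assoc (qint q (suc (count (s ∖ t) lo m))) (qfact q (count (s ∖ t) lo m)) _)
    where
    later : ∀ b → b ∈ blocks m r → ∀ x → proj₁ b < x → x ≤ proj₂ b → x ≢ t
    later b b∈ x b<x _ e = <⇒≢ (≤-<-trans t≤m (≤-<-trans (blocks-lower m r sorted b b∈) b<x)) (sym e)
  blockFactorials-∖ s t lo (m ∷ r) (_ , sorted) b (there b∈) b<t t≤b st = begin
    qfact q (count s lo m) * blockFactorials s (blocks m r)
      ≡⟨ cong₂ _*_ (sym (cong (qfact q) (count-∖-outside s t lo m earlier))) (blockFactorials-∖ s t m r sorted b b∈ b<t t≤b st) ⟩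
    qfact q (count (s ∖ t) lo m) * (qint q (count s (proj₁ b) (proj₂ b)) * blockFactorials (s ∖ t) (blocks m r))
      ≡⟨ swap-factors (qfact q (count (s ∖ t) lo m)) (qint q (count s (proj₁ b) (proj₂ b))) (blockFactorials (s ∖ t) (blocks m r)) ⟩
    qint q (count s (proj₁ b) (proj₂ b)) * (qfact q (count (s ∖ t) lo m) * blockFactorials (s ∖ t) (blocks m r)) ∎
    where
    open ≡-Reasoning
    earlier : ∀ x → lo < x → x ≤ m → x ≢ t
    earlier x _ x≤m e = <⇒≢ (≤-<-trans x≤m (≤-<-trans (blocks-lower m r sorted b b∈) b<t)) e
    swap-factors : ∀ x y z → x * (y * z) ≡ y * (x * z)
    swap-factors = solve-∀

  increase⁺-at-top : ∀ s t hi → t ≤ hi → hi ≤ n → (∀ a → t < a → a ≤ hi → ¬ T (s a)) →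
    ℓD-increase⁺ s t ≡ count s hi n
  increase⁺-at-top s t hi t≤hi hi≤n above = begin
    ΣI 0 n g                                   ≡⟨ ΣI-split 0 t n g z≤n (≤-trans t≤hi hi≤n) ⟩
    ΣI 0 t g + ΣI t n g                        ≡⟨ cong (ΣI 0 t g +_) (ΣI-split t hi n g t≤hi hi≤n) ⟩
    ΣI 0 t g + (ΣI t hi g + ΣI hi n g)
      ≡⟨ cong₂ (λ u v → u + (v + ΣI hi n g)) (ΣI-zero 0 t g below-t) (ΣI-zero t hi g up-to-hi) ⟩
    ΣI hi n g                                  ≡⟨ ΣI-cong hi n beyond-hi ⟩
    count s hi n                               ∎
    where
    open ≡-Reasoning
    g : ℕ → ℕ
    g a = if (s ∖ t) a then 𝟙 (t <ᵇ a) else 0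
    below-t : ∀ a → 0 < a → a ≤ t → g a ≡ 0
    below-t a _ a≤t rewrite ¬T⇒≡false (λ h → <⇒≱ (ℕₚ.<ᵇ⇒< t a h) a≤t) with (s ∖ t) a
    ... | true  = refl
    ... | false = refl
    up-to-hi : ∀ a → t < a → a ≤ hi → g a ≡ 0
    up-to-hi a t<a a≤hi rewrite ¬T⇒≡false (λ h → above a t<a a≤hi (proj₁ (∖-elim s t a h))) = refl
    beyond-hi : ∀ a → hi < a → a ≤ n → g a ≡ 𝟙 (s a)
    beyond-hi a hi<a _ rewrite ∖-other s t a (λ e → <⇒≢ (≤-<-trans t≤hi hi<a) (sym e))
                              | T⇒≡true (ℕₚ.<⇒<ᵇ (≤-<-trans t≤hi hi<a)) with s a
    ... | true  = refl
    ... | false = refl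

  increase⁻-at-bottom : ∀ s t lo → lo < t → t ≤ n → (∀ a → lo < a → a < t → ¬ T (s a)) →
    ℓD-increase⁻ s t ≡ count (s ∖ t) 0 n + count s 0 lo
  increase⁻-at-bottom s t lo lo<t t≤n below = begin
    ΣI 0 n (λ a → if (s ∖ t) a then 1 + 𝟙 (a <ᵇ t) else 0)    ≡⟨ ΣI-cong 0 n (λ a _ _ → split a) ⟩
    ΣI 0 n (λ a → 𝟙 ((s ∖ t) a) + g a)                        ≡⟨ ΣR-+ 0 n _ g ⟩
    count (s ∖ t) 0 n + ΣI 0 n g                               ≡⟨ cong (count (s ∖ t) 0 n +_) lower ⟩
    count (s ∖ t) 0 n + count s 0 lo                           ∎
    where
    open ≡-Reasoning
    g : ℕ → ℕ
    g a = if (s ∖ t) a then 𝟙 (a <ᵇ t) else 0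
    split : ∀ a → (if (s ∖ t) a then 1 + 𝟙 (a <ᵇ t) else 0) ≡ 𝟙 ((s ∖ t) a) + g a
    split a with (s ∖ t) a
    ... | true  = refl
    ... | false = refl
    lo≤n : lo ≤ n
    lo≤n = ≤-trans (<⇒≤ lo<t) t≤n
    up-to-lo : ∀ a → 0 < a → a ≤ lo → g a ≡ 𝟙 (s a)
    up-to-lo a _ a≤lo rewrite ∖-other s t a (<⇒≢ (≤-<-trans a≤lo lo<t)) | T⇒≡true (ℕₚ.<⇒<ᵇ (≤-<-trans a≤lo lo<t)) with s a
    ... | true  = refl
    ... | false = refl
    up-to-t : ∀ a → lo < a → a ≤ t → g a ≡ 0
    up-to-t a lo<a a≤t with a ℕ.≟ t
    ... | yes refl rewrite ∖-self s a = refl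
    ... | no ne    rewrite ¬T⇒≡false (λ h → below a lo<a (≤∧≢⇒< a≤t ne) (proj₁ (∖-elim s t a h))) = refl
    beyond-t : ∀ a → t < a → a ≤ n → g a ≡ 0
    beyond-t a t<a _ rewrite ¬T⇒≡false (λ h → <⇒≱ (ℕₚ.<ᵇ⇒< a t h) (<⇒≤ t<a)) with (s ∖ t) a
    ... | true  = refl
    ... | false = refl
    lower : ΣI 0 n g ≡ count s 0 lo
    lower = begin
      ΣI 0 n g                                 ≡⟨ ΣI-split 0 lo n g z≤n lo≤n ⟩
      ΣI 0 lo g + ΣI lo n g                    ≡⟨ cong (ΣI 0 lo g +_) (ΣI-split lo t n g (<⇒≤ lo<t) t≤n) ⟩
      ΣI 0 lo g + (ΣI lo t g + ΣI t n g)
        ≡⟨ cong₂ (λ u v → u + (v + ΣI t n g)) (ΣI-cong 0 lo up-to-lo) (ΣI-zero lo t g up-to-t) ⟩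
      count s 0 lo + ΣI t n g                  ≡⟨ cong (count s 0 lo +_) (ΣI-zero t n g beyond-t) ⟩
      count s 0 lo + 0                         ≡⟨ +-identityʳ _ ⟩
      count s 0 lo                             ∎

  h₁ : ℕ
  h₁ = firstElem n ms

  c₀ : (ℕ → Bool) → ℕ
  c₀ s = count s 0 h₁

  P : (ℕ → Bool) → ℕ → ℕ
  P s k = prodRange (c₀ s) k fq

  total : (ℕ → Bool) → ℕ
  total s = count s 0 n

  Claim : ℕ → Set
  Claim k = ∀ s → s 0 ≡ true → total s ≡ k → W s k * D s ≡ qfact q k * P s k

  if-* : ∀ (b : Bool) x y → (if b then x else 0) * y ≡ (if b then x * y else 0)
  if-* true  x y = refl
  if-* false x y = refl

  restOf : List ℕ → List (ℕ × ℕ)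
  restOf []      = []
  restOf (m ∷ r) = blocks m r

  blocks-first : ∀ l → blocks 0 l ≡ (0 , firstElem n l) ∷ restOf l
  blocks-first []      = refl
  blocks-first (m ∷ r) = refl

  module _ (sorted : Sorted 0 ms) where

    Block-of : ∀ b → b ∈ blocks 0 ms → Block (proj₁ b) (proj₂ b)
    Block-of = blocks-Block 0 ms sorted (λ m m∈ → m∈) (λ m m∈ → inj₂ m∈)

    first∈ : (0 , h₁) ∈ blocks 0 ms
    first∈ = subst ((0 , h₁) ∈_) (sym (blocks-first ms)) (here refl)

    rest⊆ : ∀ b → b ∈ restOf ms → b ∈ blocks 0 ms
    rest⊆ b b∈ = subst (b ∈_) (sym (blocks-first ms)) (there b∈)

    h₁-lower : ∀ m → m ∈ ms → h₁ ≤ m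
    h₁-lower = lower ms sorted
      where
      lower : ∀ l → Sorted 0 l → ∀ m → m ∈ l → firstElem n l ≤ m
      lower (m₁ ∷ r) _       .m₁ (here refl) = ≤-refl
      lower (m₁ ∷ r) (_ , sorted′) m (there m∈) = Sorted-lower m₁ r sorted′ m m∈

    rest-lower : ∀ b → b ∈ restOf ms → h₁ ≤ proj₁ b × proj₁ b ∈ ms
    rest-lower = go ms sorted refl
      where
      go : ∀ l → Sorted 0 l → l ≡ ms → ∀ b → b ∈ restOf l → firstElem n l ≤ proj₁ b × proj₁ b ∈ ms
      go (m₁ ∷ r) (_ , sorted′) refl b b∈ = blocks-lower m₁ r sorted′ b b∈ , blocks-lower-cut m₁ r b b∈

    ΣI-first-rest : ∀ F → ΣI 0 n F ≡ ΣI 0 h₁ F + ΣL (restOf ms) (λ b → ΣI (proj₁ b) (proj₂ b) F)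
    ΣI-first-rest F = trans (ΣI-blocks F 0 ms sorted) (cong (λ L → ΣL L (λ b → ΣI (proj₁ b) (proj₂ b) F)) (blocks-first ms))

    telescope⁺ : ∀ s lo r → Sorted lo r →
      ΣL (blocks lo r) (λ b → qint q (count s (proj₁ b) (proj₂ b)) * q ^ count s (proj₂ b) n) ≡ qint q (count s lo n)
    telescope⁺ s lo [] _ = trans (+-identityʳ _) (trans (cong (λ d → qint q (count s lo n) * q ^ ΣR n d (𝟙 ∘ s)) (ℕₚ.n∸n≡0 n))
                                                      (*-identityʳ (qint q (count s lo n))))
    telescope⁺ s lo (m ∷ r) (lo≤m , sorted′) = begin
      qint q (count s lo m) * q ^ count s m n + ΣL (blocks m r) _
        ≡⟨ cong (qint q (count s lo m) * q ^ count s m n +_) (telescope⁺ s m r sorted′) ⟩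
      qint q (count s lo m) * q ^ count s m n + qint q (count s m n)
        ≡⟨ trans (+-comm (qint q (count s lo m) * q ^ count s m n) (qint q (count s m n)))
                 (cong (qint q (count s m n) +_) (*-comm (qint q (count s lo m)) (q ^ count s m n))) ⟩
      qint q (count s m n) + q ^ count s m n * qint q (count s lo m)
        ≡⟨ sym (qint-+′ (count s lo m) (count s m n)) ⟩
      qint q (count s lo m + count s m n)
        ≡⟨ cong (qint q) (sym (ΣI-split lo m n (𝟙 ∘ s) lo≤m (Sorted-≤n m r sorted′))) ⟩
      qint q (count s lo n) ∎
      where open ≡-Reasoning

    telescope⁻ : ∀ s lo r → Sorted lo r →
      ΣL (blocks lo r) (λ b → qint q (count s (proj₁ b) (proj₂ b)) * q ^ count s 0 (proj₁ b)) ≡ q ^ count s 0 lo * qint q (count s lo n)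
    telescope⁻ s lo [] _ = trans (+-identityʳ _) (*-comm (qint q (count s lo n)) _)
    telescope⁻ s lo (m ∷ r) (lo≤m , sorted′) = begin
      qint q x * q ^ z + ΣL (blocks m r) _          ≡⟨ cong (qint q x * q ^ z +_) (telescope⁻ s m r sorted′) ⟩
      qint q x * q ^ z + q ^ count s 0 m * qint q y ≡⟨ cong (λ e → qint q x * q ^ z + q ^ e * qint q y) (ΣI-split 0 lo m (𝟙 ∘ s) z≤n lo≤m) ⟩
      qint q x * q ^ z + q ^ (z + x) * qint q y     ≡⟨ cong (λ e → qint q x * q ^ z + e * qint q y) (ℕₚ.^-distribˡ-+-* q z x) ⟩
      qint q x * q ^ z + q ^ z * q ^ x * qint q y   ≡⟨ factor (qint q x) (q ^ z) (q ^ x) (qint q y) ⟩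
      q ^ z * (qint q x + q ^ x * qint q y)         ≡⟨ cong (q ^ z *_) (sym (qint-+ x y)) ⟩
      q ^ z * qint q (x + y)                        ≡⟨ cong (λ e → q ^ z * qint q e) (sym (ΣI-split lo m n (𝟙 ∘ s) lo≤m (Sorted-≤n m r sorted′))) ⟩
      q ^ z * qint q (count s lo n)                 ∎
      where
      open ≡-Reasoning
      x = count s lo m
      y = count s m n
      z = count s 0 lo
      factor : ∀ A a b B → A * a + a * b * B ≡ a * (A + b * B)
      factor = solve-∀

    telescope⁺-rest : ∀ s → ΣL (restOf ms) (λ b → qint q (count s (proj₁ b) (proj₂ b)) * q ^ count s (proj₂ b) n) ≡ qint q (count s h₁ n)
    telescope⁺-rest s = go ms sorted
      where
      go : ∀ l → Sorted 0 l → ΣL (restOf l) (λ b → qint q (count s (proj₁ b) (proj₂ b)) * q ^ count s (proj₂ b) n) ≡ qint q (count s (firstElem n l) n)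
      go []      _             = sym (cong (λ d → qint q (ΣR n d (𝟙 ∘ s))) (ℕₚ.n∸n≡0 n))
      go (m ∷ r) (_ , sorted′) = telescope⁺ s m r sorted′

    telescope⁻-rest : ∀ s → ΣL (restOf ms) (λ b → qint q (count s (proj₁ b) (proj₂ b)) * q ^ count s 0 (proj₁ b)) ≡ q ^ c₀ s * qint q (count s h₁ n)
    telescope⁻-rest s = go ms sorted
      where
      go : ∀ l → Sorted 0 l → ΣL (restOf l) (λ b → qint q (count s (proj₁ b) (proj₂ b)) * q ^ count s 0 (proj₁ b))
                                ≡ q ^ count s 0 (firstElem n l) * qint q (count s (firstElem n l) n)
      go []      _             = sym (trans (cong (λ d → q ^ count s 0 n * qint q (ΣR n d (𝟙 ∘ s))) (ℕₚ.n∸n≡0 n)) (*-zeroʳ (q ^ count s 0 n)))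
      go (m ∷ r) (_ , sorted′) = telescope⁻ s m r sorted′

    module Step (s : ℕ → Bool) (k : ℕ) (s0 : s 0 ≡ true) (total≡ : total s ≡ suc k) (IH : Claim k) where

      IH-at : ∀ t → 0 < t → t ≤ n → T (s t) → W (s ∖ t) k * D (s ∖ t) ≡ qfact q k * P (s ∖ t) k
      IH-at t 0<t t≤n st = IH (s ∖ t) (trans (∖-other s t 0 (<⇒≢ 0<t)) s0) (total-∖ t 0<t t≤n st)
        where
        total-∖ : ∀ t → 0 < t → t ≤ n → T (s t) → total (s ∖ t) ≡ k
        total-∖ t 0<t t≤n st = ℕₚ.suc-injective (trans (sym (count-∖-inside s t 0 n 0<t t≤n st)) total≡)

      topSum : ∀ lo hi → (lo , hi) ∈ blocks 0 ms → (Y : ℕ) → (∀ t → lo < t → t ≤ hi → T (s t) → P (s ∖ t) k ≡ Y) →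
        ΣI lo hi (λ t → term⁺ s k t * D s) ≡ qint q (count s lo hi) * q ^ count s hi n * (qfact q k * Y)
      topSum lo hi b∈ Y P≡ with greatest s lo hi
      ... | inj₁ none =
        trans (ΣI-zero lo hi _ (λ t lo<t t≤hi → trans (if-* (s t ∧ isTop s t) _ (D s)) (absent t (none t lo<t t≤hi))))
              (sym (cong (λ c → qint q c * q ^ count s hi n * (qfact q k * Y)) (count-zero s lo hi none)))
        where
        absent : ∀ t → ¬ T (s t) → (if s t ∧ isTop s t then q ^ ℓD-increase⁺ s t * W (s ∖ t) k * D s else 0) ≡ 0
        absent t ¬st rewrite ¬T⇒≡false ¬st = refl
      ... | inj₂ (t₀ , lo<t₀ , t₀≤hi , st₀ , above₀) =
        trans (ΣI-cong lo hi (λ t _ _ → if-* (s t ∧ isTop s t) _ (D s)))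
              (trans (ΣI-single lo hi (λ t → s t ∧ isTop s t) F t₀ lo<t₀ t₀≤hi top₀ unique) value)
        where
        open Block (Block-of (lo , hi) b∈)
        F : ℕ → ℕ
        F t = q ^ ℓD-increase⁺ s t * W (s ∖ t) k * D s
        top₀ : T (s t₀ ∧ isTop s t₀)
        top₀ = ∧-intro st₀ (isTop-intro s t₀ (above⇒top s lo hi t₀ hi≤n separated lo<t₀ t₀≤hi top-cut above₀))
        unique : ∀ t → lo < t → t ≤ hi → T (s t ∧ isTop s t) → t ≡ t₀
        unique t lo<t t≤hi h = greatest-unique s hi t t₀ (∧-fst h) st₀ t≤hi t₀≤hi
          (top⇒above s lo hi t hi≤n separated lo<t t≤hi (isTop-elim s t (∧-snd {s t} h))) above₀
        value : F t₀ ≡ qint q (count s lo hi) * q ^ count s hi n * (qfact q k * Y)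
        value = begin
          q ^ ℓD-increase⁺ s t₀ * W (s ∖ t₀) k * D s
            ≡⟨ cong₂ (λ e d → q ^ e * W (s ∖ t₀) k * d) (increase⁺-at-top s t₀ hi t₀≤hi hi≤n above₀)
                     (blockFactorials-∖ s t₀ 0 ms sorted (lo , hi) b∈ lo<t₀ t₀≤hi st₀) ⟩
          q ^ count s hi n * W (s ∖ t₀) k * (qint q (count s lo hi) * D (s ∖ t₀))
            ≡⟨ rearrange (q ^ count s hi n) (W (s ∖ t₀) k) (qint q (count s lo hi)) (D (s ∖ t₀)) ⟩
          qint q (count s lo hi) * q ^ count s hi n * (W (s ∖ t₀) k * D (s ∖ t₀))
            ≡⟨ cong (qint q (count s lo hi) * q ^ count s hi n *_)
                    (trans (IH-at t₀ (≤-<-trans z≤n lo<t₀) (≤-trans t₀≤hi hi≤n) st₀) (cong (qfact q k *_) (P≡ t₀ lo<t₀ t₀≤hi st₀))) ⟩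
          qint q (count s lo hi) * q ^ count s hi n * (qfact q k * Y) ∎
          where
          open ≡-Reasoning
          rearrange : ∀ a w b d → a * w * (b * d) ≡ b * a * (w * d)
          rearrange = solve-∀

      bottomSum : ∀ lo hi → (lo , hi) ∈ blocks 0 ms → lo ∈ ms → (∀ t → lo < t → t ≤ hi → T (s t) → P (s ∖ t) k ≡ P s k) →
        ΣI lo hi (λ t → term⁻ s k t * D s) ≡ qint q (count s lo hi) * q ^ (k + count s 0 lo) * (qfact q k * P s k)
      bottomSum lo hi b∈ lo∈ P≡ with least s lo hi
      ... | inj₁ none =
        trans (ΣI-zero lo hi _ (λ t lo<t t≤hi → trans (if-* (s t ∧ isBottom s t) _ (D s)) (absent t (none t lo<t t≤hi))))
              (sym (cong (λ c → qint q c * q ^ (k + count s 0 lo) * (qfact q k * P s k)) (count-zero s lo hi none)))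
        where
        absent : ∀ t → ¬ T (s t) → (if s t ∧ isBottom s t then q ^ ℓD-increase⁻ s t * W (s ∖ t) k * D s else 0) ≡ 0
        absent t ¬st rewrite ¬T⇒≡false ¬st = refl
      ... | inj₂ (t₀ , lo<t₀ , t₀≤hi , st₀ , below₀) =
        trans (ΣI-cong lo hi (λ t _ _ → if-* (s t ∧ isBottom s t) _ (D s)))
              (trans (ΣI-single lo hi (λ t → s t ∧ isBottom s t) F t₀ lo<t₀ t₀≤hi bottom₀ unique) value)
        where
        open Block (Block-of (lo , hi) b∈)
        F : ℕ → ℕ
        F t = q ^ ℓD-increase⁻ s t * W (s ∖ t) k * D s
        bottom₀ : T (s t₀ ∧ isBottom s t₀)
        bottom₀ = ∧-intro st₀ (isBottom-intro s t₀ (below⇒bottom s lo hi t₀ hi≤n separated lo<t₀ t₀≤hi lo∈ below₀))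
        unique : ∀ t → lo < t → t ≤ hi → T (s t ∧ isBottom s t) → t ≡ t₀
        unique t lo<t t≤hi h = least-unique s lo t t₀ (∧-fst h) st₀ lo<t lo<t₀
          (bottom⇒below s lo hi t hi≤n separated lo<t t≤hi (isBottom-elim s t (∧-snd {s t} h))) below₀
        t₀≤n : t₀ ≤ n
        t₀≤n = ≤-trans t₀≤hi hi≤n
        value : F t₀ ≡ qint q (count s lo hi) * q ^ (k + count s 0 lo) * (qfact q k * P s k)
        value = begin
          q ^ ℓD-increase⁻ s t₀ * W (s ∖ t₀) k * D s
            ≡⟨ cong₂ (λ e d → q ^ e * W (s ∖ t₀) k * d)
                     (trans (increase⁻-at-bottom s t₀ lo lo<t₀ t₀≤n below₀)
                            (cong (_+ count s 0 lo) (ℕₚ.suc-injective (trans (sym (count-∖-inside s t₀ 0 n (≤-<-trans z≤n lo<t₀) t₀≤n st₀)) total≡))))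
                     (blockFactorials-∖ s t₀ 0 ms sorted (lo , hi) b∈ lo<t₀ t₀≤hi st₀) ⟩
          q ^ (k + count s 0 lo) * W (s ∖ t₀) k * (qint q (count s lo hi) * D (s ∖ t₀))
            ≡⟨ rearrange (q ^ (k + count s 0 lo)) (W (s ∖ t₀) k) (qint q (count s lo hi)) (D (s ∖ t₀)) ⟩
          qint q (count s lo hi) * q ^ (k + count s 0 lo) * (W (s ∖ t₀) k * D (s ∖ t₀))
            ≡⟨ cong (qint q (count s lo hi) * q ^ (k + count s 0 lo) *_)
                    (trans (IH-at t₀ (≤-<-trans z≤n lo<t₀) t₀≤n st₀) (cong (qfact q k *_) (P≡ t₀ lo<t₀ t₀≤hi st₀))) ⟩
          qint q (count s lo hi) * q ^ (k + count s 0 lo) * (qfact q k * P s k) ∎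
          where
          open ≡-Reasoning
          rearrange : ∀ a w b d → a * w * (b * d) ≡ b * a * (w * d)
          rearrange = solve-∀

      -- The first block contributes no -letter term: 0 ∈ s lies below everything there.
      firstBottoms : ΣI 0 h₁ (λ t → term⁻ s k t * D s) ≡ 0
      firstBottoms = ΣI-zero 0 h₁ _ (λ t 0<t t≤h₁ → trans (if-* (s t ∧ isBottom s t) _ (D s)) (no-term t 0<t t≤h₁))
        where
        no-term : ∀ t → 0 < t → t ≤ h₁ → (if s t ∧ isBottom s t then q ^ ℓD-increase⁻ s t * W (s ∖ t) k * D s else 0) ≡ 0
        no-term t 0<t t≤h₁ rewrite ¬T⇒≡false (λ h → no-bottom-in-first s h₁ t (≡true⇒T s0) h₁-lower 0<t t≤h₁ (isBottom-elim s t (∧-snd {s t} h))) = refl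

      S : ℕ
      S = count s h₁ n

      -- ∏_{i=c₀-1}^{k-1} (1+q^i): the product P (s ∖ t) k for t in the first block
      X₀ : ℕ
      X₀ = prodRange (pred (c₀ s)) k fq

      P-first : ∀ t → 0 < t → t ≤ h₁ → T (s t) → P (s ∖ t) k ≡ X₀
      P-first t 0<t t≤h₁ st = cong (λ c → prodRange c k fq) (sym (cong pred (count-∖-inside s t 0 h₁ 0<t t≤h₁ st)))

      P-rest : ∀ b → b ∈ restOf ms → ∀ t → proj₁ b < t → t ≤ proj₂ b → T (s t) → P (s ∖ t) k ≡ P s k
      P-rest b b∈ t lo<t _ _ = cong (λ c → prodRange c k fq)
        (count-∖-outside s t 0 h₁ (λ x _ x≤h₁ → <⇒≢ (≤-<-trans x≤h₁ (≤-<-trans (proj₁ (rest-lower b b∈)) lo<t))))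

      sum⁻ : ΣI 0 n (λ t → term⁻ s k t * D s) ≡ q ^ k * (q ^ c₀ s * qint q S) * (qfact q k * P s k)
      sum⁻ = begin
        ΣI 0 n F
          ≡⟨ ΣI-first-rest F ⟩
        ΣI 0 h₁ F + ΣL (restOf ms) (λ b → ΣI (proj₁ b) (proj₂ b) F)
          ≡⟨ cong₂ _+_ firstBottoms (ΣL-cong (restOf ms) (λ b b∈ →
               trans (bottomSum (proj₁ b) (proj₂ b) (rest⊆ b b∈) (proj₂ (rest-lower b b∈)) (P-rest b b∈))
                     (cong (_* (qfact q k * P s k)) (split-power (qint q (count s (proj₁ b) (proj₂ b))) (count s 0 (proj₁ b)))))) ⟩
        ΣL (restOf ms) (λ b → q ^ k * (qint q (count s (proj₁ b) (proj₂ b)) * q ^ count s 0 (proj₁ b)) * (qfact q k * P s k))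
          ≡⟨ ΣL-*ʳ (restOf ms) _ (qfact q k * P s k) ⟩
        ΣL (restOf ms) (λ b → q ^ k * (qint q (count s (proj₁ b) (proj₂ b)) * q ^ count s 0 (proj₁ b))) * (qfact q k * P s k)
          ≡⟨ cong (_* (qfact q k * P s k)) (trans (ΣL-* (restOf ms) (q ^ k) _) (cong (q ^ k *_) (telescope⁻-rest s))) ⟩
        q ^ k * (q ^ c₀ s * qint q S) * (qfact q k * P s k) ∎
        where
        open ≡-Reasoning
        F : ℕ → ℕ
        F t = term⁻ s k t * D s
        split-power : ∀ c x → c * q ^ (k + x) ≡ q ^ k * (c * q ^ x)
        split-power c x = trans (cong (c *_) (ℕₚ.^-distribˡ-+-* q k x)) (swap c (q ^ k) (q ^ x))
          where
          swap : ∀ a b c → a * (b * c) ≡ b * (a * c)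
          swap = solve-∀

      sum⁺ : ΣI 0 n (λ t → term⁺ s k t * D s) ≡ qint q (c₀ s) * q ^ S * (qfact q k * X₀) + qint q S * (qfact q k * P s k)
      sum⁺ = begin
        ΣI 0 n F
          ≡⟨ ΣI-first-rest F ⟩
        ΣI 0 h₁ F + ΣL (restOf ms) (λ b → ΣI (proj₁ b) (proj₂ b) F)
          ≡⟨ cong₂ _+_ (topSum 0 h₁ first∈ X₀ P-first)
                       (ΣL-cong (restOf ms) (λ b b∈ → topSum (proj₁ b) (proj₂ b) (rest⊆ b b∈) (P s k) (P-rest b b∈))) ⟩
        qint q (c₀ s) * q ^ S * (qfact q k * X₀)
          + ΣL (restOf ms) (λ b → qint q (count s (proj₁ b) (proj₂ b)) * q ^ count s (proj₂ b) n * (qfact q k * P s k))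
          ≡⟨ cong (qint q (c₀ s) * q ^ S * (qfact q k * X₀) +_)
                  (trans (ΣL-*ʳ (restOf ms) _ (qfact q k * P s k)) (cong (_* (qfact q k * P s k)) (telescope⁺-rest s))) ⟩
        qint q (c₀ s) * q ^ S * (qfact q k * X₀) + qint q S * (qfact q k * P s k) ∎
        where
        open ≡-Reasoning
        F : ℕ → ℕ
        F t = term⁺ s k t * D s

      c₀+S : c₀ s + S ≡ suc k
      c₀+S = trans (sym (ΣI-split 0 h₁ n (𝟙 ∘ s) z≤n (Block.hi≤n (Block-of (0 , h₁) first∈)))) total≡

      result : W s (suc k) * D s ≡ qfact q (suc k) * P s (suc k)
      result = begin
        W s (suc k) * D s
          ≡⟨ cong (_* D s) (W-step s k) ⟩
        (ΣR 0 n (term⁻ s k) + ΣR 0 n (term⁺ s k)) * D s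
          ≡⟨ ℕₚ.*-distribʳ-+ (D s) (ΣR 0 n (term⁻ s k)) (ΣR 0 n (term⁺ s k)) ⟩
        ΣR 0 n (term⁻ s k) * D s + ΣR 0 n (term⁺ s k) * D s
          ≡⟨ cong₂ _+_ (trans (ΣR-*ʳ 0 n (term⁻ s k) (D s)) sum⁻) (trans (ΣR-*ʳ 0 n (term⁺ s k) (D s)) sum⁺) ⟩
        q ^ k * (q ^ c₀ s * qint q S) * (qfact q k * P s k) + (qint q (c₀ s) * q ^ S * (qfact q k * X₀) + qint q S * (qfact q k * P s k))
          ≡⟨ factor-out (q ^ k) (q ^ c₀ s) (qint q S) (qfact q k) (P s k) (qint q (c₀ s)) (q ^ S) X₀ ⟩
        qfact q k * (qint q (c₀ s) * q ^ S * X₀ + qint q S * P s k + q ^ k * q ^ c₀ s * qint q S * P s k)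
          ≡⟨ cong (qfact q k *_) (step-identity (c₀ s) S k c₀+S) ⟩
        qfact q k * (qint q (suc k) * P s (suc k))
          ≡⟨ reorder (qfact q k) (qint q (suc k)) (P s (suc k)) ⟩
        qfact q (suc k) * P s (suc k) ∎
        where
        open ≡-Reasoning
        factor-out : ∀ a b σ f y c α x → a * (b * σ) * (f * y) + (c * α * (f * x) + σ * (f * y)) ≡ f * (c * α * x + σ * y + a * b * σ * y)
        factor-out = solve-∀
        reorder : ∀ f g p → f * (g * p) ≡ g * f * p
        reorder = solve-∀

    blockFactorials-one : ∀ s L → (∀ b → b ∈ L → count s (proj₁ b) (proj₂ b) ≡ 0) → blockFactorials s L ≡ 1
    blockFactorials-one s []      h = refl
    blockFactorials-one s (b ∷ L) h rewrite h b (here refl) = trans (+-identityʳ _) (blockFactorials-one s L (λ b′ b′∈ → h b′ (there b′∈)))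

    base : ∀ s → total s ≡ 0 → W s 0 * D s ≡ qfact q 0 * P s 0
    base s total≡0 = begin
      W s 0 * D s      ≡⟨ cong₂ _*_ W≡1 D≡1 ⟩
      1                ≡⟨ cong (1 *_) (sym (prodRange-empty (c₀ s) 0 fq z≤n)) ⟩
      1 * P s 0        ∎
      where
      open ≡-Reasoning
      empty : ∀ t → 0 < t → t ≤ n → ¬ T (s t)
      empty t 0<t t≤n st = subst T (cong-𝟙 (ΣR-zero-inv 0 n (𝟙 ∘ s) total≡0 t 0<t t≤n)) st
        where
        cong-𝟙 : ∀ {b} → 𝟙 b ≡ 0 → b ≡ false
        cong-𝟙 {false} _ = refl
      admissible-[] : admissible s [] ≡ true
      admissible-[] = T⇒≡true (∧-intro (uses-intro s [] (tt , λ t 0<t t≤n → ¬T⇒≡false (empty t 0<t t≤n)))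
                                        (monotone-intro s [] (λ t t′ _ t′≤n _ st′ t<t′ _ → ⊥-elim (empty t′ (≤-<-trans z≤n t<t′) t′≤n st′))))
      W≡1 : W s 0 ≡ 1
      W≡1 rewrite admissible-[] = refl
      D≡1 : D s ≡ 1
      D≡1 = blockFactorials-one s (blocks 0 ms) (λ b b∈ → count-zero s (proj₁ b) (proj₂ b)
              (λ t lo<t t≤hi → empty t (≤-<-trans z≤n lo<t) (≤-trans t≤hi (blocks-≤n 0 ms sorted b b∈))))

    main : ∀ k → Claim k
    main zero    s _  total≡ = base s total≡
    main (suc k) s s0 total≡ = Step.result s k s0 total≡ (main k)

-- Des_B(β⁻¹) ⊆ M says that for every j < n, j ∈ M or
-- β⁻¹(j) ≤ β⁻¹(j+1) (with β⁻¹(0) = 0).  Chaining these steps, this is the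
-- same as block-monotonicity of β on the full value set.
module InverseDescents (n : ℕ) (ms : List ℕ) where
  open import Data.Bool.ListAction using (all)
  import Data.List.Relation.Unary.All as All
  open import Data.List.Relation.Unary.All.Properties using (all⁺; all⁻)
  import Data.List.Relation.Unary.Any as Any
  open import Data.List.Relation.Unary.Any.Properties using (any⁺; any⁻)
  open import Data.List.Properties using (map-upTo)
  open Admissible n ms
  open Blocks n ms using (noCut-intro; noCut-elim)

  segment : (ℕ → ℤ) → ℕ → ℕ → List ℤ
  segment U i zero    = []
  segment U i (suc d) = U (suc i) ∷ segment U (suc i) d

  module _ (p : ℕ → Bool) (U : ℕ → ℤ) where

    GoodStep : ℕ → Set
    GoodStep j = T (p j) ⊎ U j ℤ.≤ U (suc j)

    descents⇒steps : ∀ d i → All (T ∘ p) (desFrom i (U i) (segment U i d)) → ∀ j → i ≤ j → j < i + d → GoodStep j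
    descents⇒steps zero    i h j i≤j j<i+0 = ⊥-elim (<⇒≱ j<i+0 (≤-trans (≤-reflexive (+-identityʳ i)) i≤j))
    descents⇒steps (suc d) i h j i≤j j<i+d+1 with U (suc i) ℤ.<? U i | i ℕ.≟ j
    ... | yes _ | yes refl = inj₁ (All.head h)
    ... | no ≮  | yes refl = inj₂ (ℤₚ.≮⇒≥ ≮)
    ... | yes _ | no i≢j   = descents⇒steps d (suc i) (All.tail h) j (≤∧≢⇒< i≤j i≢j) (≤-trans j<i+d+1 (≤-reflexive (+-suc i d)))
    ... | no _  | no i≢j   = descents⇒steps d (suc i) h j (≤∧≢⇒< i≤j i≢j) (≤-trans j<i+d+1 (≤-reflexive (+-suc i d)))

    steps⇒descents : ∀ d i → (∀ j → i ≤ j → j < i + d → GoodStep j) → All (T ∘ p) (desFrom i (U i) (segment U i d))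
    steps⇒descents zero    i h = []
    steps⇒descents (suc d) i h with U (suc i) ℤ.<? U i | h i ≤-refl (≤-trans (s≤s (ℕₚ.m≤m+n i d)) (≤-reflexive (sym (+-suc i d))))
    ... | yes _  | inj₁ pi = pi ∷ rest
      where rest = steps⇒descents d (suc i) (λ j i<j j<· → h j (<⇒≤ i<j) (≤-trans j<· (≤-reflexive (sym (+-suc i d)))))
    ... | yes lt | inj₂ le = ⊥-elim (ℤₚ.<⇒≱ lt le)
    ... | no _   | _       = steps⇒descents d (suc i) (λ j i<j j<· → h j (<⇒≤ i<j) (≤-trans j<· (≤-reflexive (sym (+-suc i d)))))

  steps⇒≤ : ∀ (U : ℕ → ℤ) a d → (∀ j → a ≤ j → j < a + d → U j ℤ.≤ U (suc j)) → U a ℤ.≤ U (a + d)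
  steps⇒≤ U a zero    h = ℤₚ.≤-reflexive (cong U (sym (+-identityʳ a)))
  steps⇒≤ U a (suc d) h = ℤₚ.≤-trans (steps⇒≤ U a d (λ j a≤j j<a+d → h j a≤j (≤-trans j<a+d (ℕₚ.+-monoʳ-≤ a (ℕₚ.n≤1+n d)))))
    (subst (λ z → U (a + d) ℤ.≤ U z) (sym (+-suc a d)) (h (a + d) (ℕₚ.m≤m+n a d) (≤-reflexive (sym (+-suc a d)))))

  ∈ᵇ⇒∈ : ∀ j xs → T (j ∈ᵇ xs) → j ∈ xs
  ∈ᵇ⇒∈ j xs h = Any.map (ℕₚ.≡ᵇ⇒≡ j _) (any⁻ _ xs h)

  ∈⇒∈ᵇ : ∀ j xs → j ∈ xs → T (j ∈ᵇ xs)
  ∈⇒∈ᵇ j xs j∈ = any⁺ _ (Any.map (ℕₚ.≡⇒≡ᵇ j _) j∈)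

  InverseSteps : List ℤ → Set
  InverseSteps w = ∀ j → j < n → T (j ∈ᵇ ms) ⊎ V w j ℤ.≤ V w (suc j)

  applyUpTo≡segment : ∀ (U : ℕ → ℤ) d i (F : ℕ → ℤ) → (∀ j → F j ≡ U (suc (i + j))) → applyUpTo F d ≡ segment U i d
  applyUpTo≡segment U zero    i F h = refl
  applyUpTo≡segment U (suc d) i F h =
    cong₂ _∷_ (trans (h 0) (cong (U ∘ suc) (+-identityʳ i)))
              (applyUpTo≡segment U d (suc i) (F ∘ suc) (λ j → trans (h (suc j)) (cong (U ∘ suc) (+-suc i j))))

  inverse≡segment : ∀ w → length w ≡ n → inverse w ≡ segment (V w) 0 n
  inverse≡segment w len = trans (cong (λ d → map (λ j → invAt (suc j) w 1) (upTo d)) len)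
                                (trans (map-upTo (λ j → invAt (suc j) w 1) n) (applyUpTo≡segment (V w) n 0 _ (λ j → refl)))

  desInM : List ℤ → Bool
  desInM v = all (_∈ᵇ ms) (DesB v)

  DesB-inverse : ∀ w → length w ≡ n → All (Letter n) w → DesB (inverse w) ≡ desFrom 0 (V w 0) (segment (V w) 0 n)
  DesB-inverse w len ls = cong₂ (desFrom 0) (sym (V-zero w ls)) (inverse≡segment w len)

  desInM⇒steps : ∀ w → length w ≡ n → All (Letter n) w → T (desInM (inverse w)) → InverseSteps w
  desInM⇒steps w len ls h j j<n =
    descents⇒steps (_∈ᵇ ms) (V w) n 0 (subst (All (T ∘ (_∈ᵇ ms))) (DesB-inverse w len ls) (all⁺ (_∈ᵇ ms) _ h)) j z≤n j<n

  steps⇒desInM : ∀ w → length w ≡ n → All (Letter n) w → InverseSteps w → T (desInM (inverse w))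
  steps⇒desInM w len ls steps =
    all⁻ (_∈ᵇ ms) (subst (All (T ∘ (_∈ᵇ ms))) (sym (DesB-inverse w len ls)) (steps⇒descents (_∈ᵇ ms) (V w) n 0 (λ j _ j<n → steps j j<n)))

  everything : ℕ → Bool
  everything _ = true

  monotone⇒steps : ∀ w → BlockMonotone everything w → InverseSteps w
  monotone⇒steps w g j j<n with j ∈ᵇ ms in eq
  ... | true  = inj₁ tt
  ... | false = inj₂ (g j (suc j) (<⇒≤ j<n) j<n tt tt (ℕₚ.n<1+n j) (noCut-intro j (suc j) no-cut))
    where
    no-cut : ∀ m → m ∈ ms → j ≤ m → m < suc j → ⊥
    no-cut m m∈ j≤m m<j+1 with ℕₚ.≤-antisym j≤m (≤-pred m<j+1)
    ... | refl = subst T eq (∈⇒∈ᵇ m ms m∈)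

  steps⇒monotone : ∀ w → InverseSteps w → BlockMonotone everything w
  steps⇒monotone w steps t t′ _ t′≤n _ _ t<t′ nc =
    subst (λ z → V w t ℤ.≤ V w z) (ℕₚ.m+[n∸m]≡n (<⇒≤ t<t′))
      (steps⇒≤ (V w) t (t′ ∸ t) (λ j t≤j j<· → up j t≤j (≤-trans j<· (≤-reflexive (ℕₚ.m+[n∸m]≡n (<⇒≤ t<t′))))))
    where
    up : ∀ j → t ≤ j → j < t′ → V w j ℤ.≤ V w (suc j)
    up j t≤j j<t′ with steps j (<-≤-trans j<t′ t′≤n)
    ... | inj₁ j∈ = ⊥-elim (noCut-elim t t′ j (∈ᵇ⇒∈ j ms j∈) t≤j j<t′ nc)
    ... | inj₂ le = le

-- Take ms = M (sorted) and the full value set: the admissible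
-- words of length n are exactly the β ∈ B_n with Des_B(β⁻¹) ⊆ M, every block
-- count is the corresponding part of (m₁, m₂-m₁, …, n-m_t), and c₀ = m₁.  The
-- main induction gives W · ∏[parts]! = [n]! · ∏_{i=m₁}^{n-1}(1+q^i), and
-- dividing by ∏[parts]! (which divides [n]!) gives the q-multinomial.
module Specialisation (n : ℕ) (M : Subset n) (q : ℕ) where
  open import Data.Fin as Fin using (Fin; toℕ)
  open import Data.List using (zipWith; allFin; tabulate)
  open import Data.List.Properties using (length-map)
  open import Data.Vec using (lookup)

  ms : List ℕ
  ms = elems M

  open Admissible n ms
  open Weighted n ms q
  open Blocks n ms
  open QArithmetic q
  open Induction n ms q
  open InverseDescents n ms

  admissible-everything : ∀ w → length w ≡ n → All (Letter n) w →
    admissible everything w ≡ distinct (map ∣_∣ w) ∧ desSubset (inverse w) M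
  admissible-everything w len ls = bool-ext to from
    where
    to : T (admissible everything w) → T (distinct (map ∣_∣ w) ∧ desSubset (inverse w) M)
    to h = ∧-intro (proj₁ (uses-elim everything w (∧-fst h)))
                   (steps⇒desInM w len ls (monotone⇒steps w (monotone-elim everything w (∧-snd {usesᵇ everything w} h))))
    from : T (distinct (map ∣_∣ w) ∧ desSubset (inverse w) M) → T (admissible everything w)
    from h = ∧-intro (uses-intro everything w (d , λ t 1≤t t≤n → sym (pigeonhole n (absL w) d (absL-InRange w ls) (trans (length-map ∣_∣ w) len) t 1≤t t≤n)))
                     (monotone-intro everything w (steps⇒monotone w (desInM⇒steps w len ls (∧-snd {distinct (map ∣_∣ w)} h))))
      where d = ∧-fst h

  sum-over-B≡W : sum (map (λ β → q ^ ℓD β) (filterᵇ (λ β → desSubset (inverse β) M) (B n))) ≡ W everything n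
  sum-over-B≡W = begin
    ΣL (filterᵇ (λ β → desSubset (inverse β) M) (B n)) (λ β → q ^ ℓD β)
      ≡⟨ ΣL-filter (B n) _ (λ β → q ^ ℓD β) ⟩
    ΣL (B n) (λ β → if desSubset (inverse β) M then q ^ ℓD β else 0)
      ≡⟨ ΣL-filter (words alphabet n) (λ w → distinct (map ∣_∣ w)) _ ⟩
    ΣL (words alphabet n) (λ w → if distinct (map ∣_∣ w) then (if desSubset (inverse w) M then q ^ ℓD w else 0) else 0)
      ≡⟨ words-cong (Letter n) alphabet (alphabet-Letter n) n (λ w ls len → same-weight w len ls) ⟩
    W everything n ∎
    where
    open ≡-Reasoning
    same-weight : ∀ w → length w ≡ n → All (Letter n) w →
      (if distinct (map ∣_∣ w) then (if desSubset (inverse w) M then q ^ ℓD w else 0) else 0) ≡ weight everything w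
    same-weight w len ls rewrite admissible-everything w len ls with distinct (map ∣_∣ w)
    ... | true  = refl
    ... | false = refl

  Sorted-weaken : ∀ lo lo′ L → lo ≤ lo′ → Sorted lo′ L → Sorted lo L
  Sorted-weaken lo lo′ []      lo≤lo′ h       = ≤-trans lo≤lo′ h
  Sorted-weaken lo lo′ (m ∷ L) lo≤lo′ (p , h) = ≤-trans lo≤lo′ p , h

  Sorted-filter : ∀ lo (F : List (Fin n)) (p : Fin n → Bool) → Sorted lo (map toℕ F) → Sorted lo (map toℕ (filterᵇ p F))
  Sorted-filter lo []      p h       = h
  Sorted-filter lo (x ∷ F) p (lo≤x , h) with p x
  ... | true  = lo≤x , Sorted-filter (toℕ x) F p h
  ... | false = Sorted-weaken lo (toℕ x) _ lo≤x (Sorted-filter (toℕ x) F p h)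

  Sorted-allFin : Sorted 0 (map toℕ (allFin n))
  Sorted-allFin = go n (λ i → i) 0 (λ i → refl) ≤-refl
    where
    go : ∀ d (f : Fin d → Fin n) c → (∀ i → toℕ (f i) ≡ c + toℕ i) → c + d ≤ n → Sorted c (map toℕ (tabulate f))
    go zero    f c _ c≤n   = ≤-trans (ℕₚ.m≤m+n c 0) c≤n
    go (suc d) f c h c+d≤n =
      ≤-reflexive (sym (trans (h Fin.zero) (+-identityʳ c))) ,
      subst (λ z → Sorted z (map toℕ (tabulate (f ∘ Fin.suc)))) (sym (trans (h Fin.zero) (+-identityʳ c)))
        (Sorted-weaken c (suc c) _ (ℕₚ.n≤1+n c)
          (go d (f ∘ Fin.suc) (suc c) (λ i → trans (h (Fin.suc i)) (+-suc c (toℕ i))) (≤-trans (≤-reflexive (sym (+-suc c d))) c+d≤n)))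

  ms-sorted : Sorted 0 ms
  ms-sorted = Sorted-filter 0 (allFin n) (lookup M) Sorted-allFin

  parts≡blocks : ∀ lo l → zipWith (λ a b → b ∸ a) (lo ∷ l) (l ++ [ n ]) ≡ map (λ b → proj₂ b ∸ proj₁ b) (blocks lo l)
  parts≡blocks lo []      = refl
  parts≡blocks lo (m ∷ l) = cong ((m ∸ lo) ∷_) (parts≡blocks m l)

  sum-blocks : ∀ lo l → Sorted lo l → sum (map (λ b → proj₂ b ∸ proj₁ b) (blocks lo l)) ≡ n ∸ lo
  sum-blocks lo []      _             = +-identityʳ (n ∸ lo)
  sum-blocks lo (m ∷ l) (lo≤m , sorted) =
    trans (cong ((m ∸ lo) +_) (sum-blocks m l sorted)) (∸-split lo m n lo≤m (Sorted-≤n m l sorted))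

  count-everything : ∀ lo hi → count everything lo hi ≡ hi ∸ lo
  count-everything lo hi = ΣR-const1 lo (hi ∸ lo)

  D-everything : D everything ≡ product (map (qfact q) (parts n ms))
  D-everything = cong product (begin
    map (λ b → qfact q (count everything (proj₁ b) (proj₂ b))) (blocks 0 ms)
      ≡⟨ map-cong (λ b → cong (qfact q) (count-everything (proj₁ b) (proj₂ b))) (blocks 0 ms) ⟩
    map (λ b → qfact q (proj₂ b ∸ proj₁ b)) (blocks 0 ms)
      ≡⟨ map-∘ (blocks 0 ms) ⟩
    map (qfact q) (map (λ b → proj₂ b ∸ proj₁ b) (blocks 0 ms))
      ≡⟨ cong (map (qfact q)) (sym (parts≡blocks 0 ms)) ⟩
    map (qfact q) (parts n ms) ∎)
    where
    open ≡-Reasoning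
    open import Data.List.Properties using (map-cong; map-∘)

  P-everything : P everything n ≡ prodRange (firstElem n ms) n fq
  P-everything = cong (λ c → prodRange c n fq) (count-everything 0 (firstElem n ms))

  sum-parts : sum (parts n ms) ≡ n
  sum-parts = trans (cong sum (parts≡blocks 0 ms)) (sum-blocks 0 ms ms-sorted)

  quotient : ℕ
  quotient = proj₁ (qmultinomial-integral (parts n ms))

  quotient-spec : quotient * product (map (qfact q) (parts n ms)) ≡ qfact q n
  quotient-spec = trans (proj₂ (qmultinomial-integral (parts n ms))) (cong (qfact q) sum-parts)

  W-everything : W everything n * product (map (qfact q) (parts n ms)) ≡ qfact q n * prodRange (firstElem n ms) n fq
  W-everything = subst₂ (λ d p → W everything n * d ≡ qfact q n * p) D-everything P-everything
                        (main ms-sorted n everything refl (ΣR-const1 0 n))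
-- Lemma 4.4.
lemma4p4 : (n : ℕ) → 1 ≤ n → (M : Subset n) → (q : ℕ) →
    sum (map (λ β → q ^ ℓD β) (filterᵇ (λ β → desSubset (inverse β) M) (B n)))
      ≡ qMultinomial q n (parts n (elems M))
        * prodRange (firstElem n (elems M)) n (λ i → 1 + q ^ i)
lemma4p4 n _ M q =
  trans sum-over-B≡W
        (divide-out (W everything n) (qfact q n) (prodRange (firstElem n ms) n fq) quotient (product (map (qfact q) (parts n ms)))
                    {{prodQfact-nonZero q (parts n ms)}} quotient-spec W-everything)
  where
  open Specialisation n M q
  open Weighted n ms q using (W)
  open InverseDescents n ms using (everything)
  open QArithmetic q using (fq; divide-out)
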